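{- Let $G$ be a finite group, $\mathcal{H}$ a finite multiset of subgroups of $G$, and $\mathcal{D}$ an admissible set of subgroups of $G$. Then $\operatorname{Sha}_{\mathcal{D}}^{2}(G,J_{G/\mathcal{H}})=\operatorname{Sha}_{\mathcal{D}_{(\mathcal{H})}}^{2}(G,J_{G/\mathcal{H}})$, where $\mathcal{D}_{(\mathcal{H})}:=\mathcal{D}\setminus\{D\in\mathcal{C}_{G}\mid D\not\subset H\text{ for every }H\in\mathcal{H}\}$ and $\mathcal{C}_G$ is the set of cyclic subgroups of $G$.
   Context: For a finite multiset $\mathcal{H}$ of subgroups of $G$, $J_{G/\mathcal{H}}$ is the cokernel of the $G$-map $\mathbb{Z}\to\bigoplus_{H\in\mathcal{H}}\operatorname{Ind}_H^G\mathbb{Z}$ (sum with multiplicity) sending $1$ to the constant function $1$ in each summand, where $\operatorname{Ind}_H^G\mathbb{Z}=\mathrm{Hom}_{\mathbb{Z}[H]}(\mathbb{Z}[G],\mathbb{Z})$ with $(g\varphi)(g')=\varphi(g'g)$. For a set $\mathcal{D}$ of subgroups and a $G$-module $M$, $\operatorname{Sha}^2_{\mathcal{D}}(G,M):=\ker\big(H^2(G,M)\to\bigoplus_{D\in\mathcal{D}}H^2(D,M)\big)$. A finite set of subgroups of $G$ is admissible if it contains all cyclic subgroups and is stable under conjugation. -}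

module Defs where

open import Data.Nat using (ℕ; zero; suc)
open import Data.Fin using (Fin)
open import Data.Fin.Subset using (Subset; _∈_; _⊆_)
open import Data.Integer using (ℤ; _+_; _-_; 0ℤ)
open import Data.List using (List; length; lookup)
open import Data.List.Relation.Unary.All using (All)
open import Data.List.Membership.Propositional renaming (_∈_ to _∈ₗ_)
open import Data.Product using (Σ; proj₁; ∃; ∃-syntax; _×_; _,_)
open import Function.Bundles using (_⇔_)
open import Relation.Binary.PropositionalEquality using (_≡_)
open import Relation.Nullary using (¬_)
open import Algebra.Structures using (IsGroup)

record FinGroup : Set where
  field
    order : ℕ
    _∙_   : Fin order → Fin order → Fin order
    ε     : Fin order
    _⁻¹   : Fin order → Fin order
    isGroup : IsGroup _≡_ _∙_ ε _⁻¹
  infixl 7 _∙_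

module _ (G : FinGroup) where
  open FinGroup G

  El : Set
  El = Fin order

  pow : El → ℕ → El
  pow g zero    = ε
  pow g (suc k) = g ∙ pow g k

  record IsSubgroup (S : Subset order) : Set where
    field
      ε∈  : ε ∈ S
      ∙∈  : ∀ {x y} → x ∈ S → y ∈ S → (x ∙ y) ∈ S
      ⁻¹∈ : ∀ {x} → x ∈ S → (x ⁻¹) ∈ S

  IsCyclic : Subset order → Set
  IsCyclic S = ∃[ g ] (∀ x → (x ∈ S) ⇔ (∃[ k ] x ≡ pow g k))

  IsConjugate : El → Subset order → Subset order → Set
  IsConjugate g S T = ∀ x → (x ∈ T) ⇔ ((((g ⁻¹) ∙ x) ∙ g) ∈ S)

  record Admissible (𝒟 : List (Subset order)) : Set where
    field
      subgroups : All IsSubgroup 𝒟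
      cyclic    : ∀ S → IsCyclic S → S ∈ₗ 𝒟
      conjStable : ∀ D g T → D ∈ₗ 𝒟 → IsConjugate g D T → T ∈ₗ 𝒟

  module _ (ℋ : List (Subset order)) where
    k : ℕ
    k = length ℋ

    -- underlying functions of ⊕_{i} Ind_{H_i}^G ℤ
    Raw : Set
    Raw = Fin k → El → ℤ

    -- membership in ⊕ Ind: each component φ_i is left H_i-invariant
    InSum : Raw → Set
    InSum φ = ∀ i h x → h ∈ lookup ℋ i → φ i (h ∙ x) ≡ φ i x

    act : El → Raw → Raw
    act g φ i x = φ i (x ∙ g)

    _⊕_ : Raw → Raw → Raw
    (φ ⊕ ψ) i x = φ i x + ψ i x

    _⊖_ : Raw → Raw → Raw
    (φ ⊖ ψ) i x = φ i x - ψ i x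

    -- equality in J = cokernel of ℤ → ⊕ Ind (1 ↦ constant 1 in every summand)
    _≈J_ : Raw → Raw → Set
    φ ≈J ψ = ∃[ c ] (∀ i x → φ i x ≡ ψ i x + c)

    -- inhomogeneous 2-cochains / 1-cochains with values in J (via representatives in ⊕ Ind)
    Cochain2 : Set
    Cochain2 = Σ (El → El → Raw) (λ f → ∀ a b → InSum (f a b))

    Cochain1 : Set
    Cochain1 = Σ (El → Raw) (λ u → ∀ a → InSum (u a))

    IsCocycle : Cochain2 → Set
    IsCocycle (f , _) = ∀ a b c →
      (((act a (f b c) ⊖ f (a ∙ b) c) ⊕ f a (b ∙ c)) ⊖ f a b) ≈J (λ _ _ → 0ℤ)

    ResIsCoboundary : Cochain2 → Subset order → Set
    ResIsCoboundary (f , _) D = Σ Cochain1 λ u → (∀ a b → a ∈ D → b ∈ D →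
      f a b ≈J ((act a (proj₁ u b) ⊖ proj₁ u (a ∙ b)) ⊕ proj₁ u a))

    InSha : (Subset order → Set) → Cochain2 → Set
    InSha P f = ∀ D → P D → ResIsCoboundary f D

    InDℋ : List (Subset order) → Subset order → Set
    InDℋ 𝒟 D = D ∈ₗ 𝒟 × ¬ (IsCyclic D × (∀ H → H ∈ₗ ℋ → ¬ (D ⊆ H)))

module Submission where

-- Non-cyclic members of 𝒟 already lie in 𝒟_(ℋ), so let D = ⟨σ⟩ be cyclic of order n.  The
-- restriction of a 2-cocycle f to D is a coboundary as soon as A = Σₜ f(σᵗ, σ), which is
-- σ-invariant, is a norm N_σ ψ modulo the constants (periodicity H²(D, J) ≅ Ĥ⁰(D, J)).
-- Now J is a permutation module with basis ⊔ᵢ Hᵢ\G modulo the constants.  If ⟨σᵐ⟩ is the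
-- stabiliser in D of the coset Hᵢx, the cyclic group x⟨σᵐ⟩x⁻¹ lies in Hᵢ, hence in 𝒟_(ℋ),
-- so f is a coboundary on it, and conjugating back shows that A is a norm from ⟨σᵐ⟩.
-- Bézout combinations of these facts make A a norm from ⟨σᵍ⟩, g the gcd of all the m.
-- Since every stabiliser lies in ⟨σᵍ⟩, keeping a preimage only on one ⟨σᵍ⟩-orbit inside
-- each D-orbit of ⊔ᵢ Hᵢ\G turns it into a preimage under the norm of D itself.

open import Defs
open import Data.Bool using (Bool; true; false; if_then_else_)
open import Data.Empty using (⊥-elim)
open import Data.Fin using (Fin; toℕ)
import Data.Fin.Properties as Fin
open import Data.Fin.Subset using (Subset; _∈_; _⊆_)
open import Data.Fin.Subset.Properties using (_∈?_)
open import Data.List using (List; []; _∷_; foldr; lookup; cartesianProduct; allFin)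
open import Data.List.Membership.Propositional renaming (_∈_ to _∈ₗ_)
open import Data.List.Membership.Propositional.Properties using (∈-lookup; ∈-allFin; ∈-cartesianProduct⁺)
open import Data.List.Relation.Unary.All as All using (All)
open import Data.List.Relation.Unary.Any using (here; there)
open import Data.Nat as ℕ using (ℕ; zero; suc; pred; NonZero; _<_; _≤_; _∸_; _%_; _/_; s≤s; z≤n)
import Data.Nat.Properties as ℕ
open import Data.Nat.DivMod using (m≡m%n+[m/n]*n; [m+kn]%n≡m%n; m%n<n; m<n⇒m%n≡m)
open import Data.Nat.Divisibility using (_∣_; divides; ∣-trans; m%n≡0⇒n∣m)
open import Data.Integer as ℤ using (ℤ; 0ℤ; 1ℤ)
import Data.Integer.Properties as ℤ
open import Data.Product using (∃; ∃-syntax; _×_; _,_; proj₁; proj₂; uncurry)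
open import Data.Sum using (inj₁; inj₂)
import Data.Vec as Vec
import Data.Vec.Properties as Vec
open import Function using (_∘_)
open import Function.Bundles using (_⇔_; mk⇔; Equivalence)
open import Level using (0ℓ)
open import Relation.Binary.PropositionalEquality
open import Relation.Nullary using (¬_; Dec; yes; no; does)
open import Relation.Nullary.Decidable using (map′; _×-dec_; _→-dec_; dec-true; does-⇔)
open import Relation.Unary using (Pred; Decidable)

module LeastElements where

  open import Data.Nat using (_+_; _*_)
  open import Data.Nat.Induction using (<-wellFounded)
  open import Data.Nat.Properties using (+-comm; +-assoc; +-identityʳ; <-cmp; anyUpTo?)
  open import Induction.WellFounded using (Acc; acc)
  open import Relation.Binary.Definitions using (tri<; tri≈; tri>)

  Least : Pred ℕ 0ℓ → ℕ → Set
  Least P n = P n × (∀ {m} → m < n → ¬ P m)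

  module _ {P : Pred ℕ 0ℓ} (P? : Decidable P) where

    private
      least-below : ∀ {n} → Acc _<_ n → P n → ∃ (Least P)
      least-below {n} (acc rec) p with anyUpTo? P? n
      ... | yes (m , m<n , q) = least-below (rec m<n) q
      ... | no none = n , p , λ m<n q → none (_ , m<n , q)

    least : ∀ {n} → P n → ∃ (Least P)
    least = least-below (<-wellFounded _)

  least-unique : ∀ {P Q : Pred ℕ 0ℓ} → (∀ {k} → P k ⇔ Q k) → ∀ {m n} → Least P m → Least Q n → m ≡ n
  least-unique P⇔Q {m} {n} (pm , m-min) (qn , n-min) with <-cmp m n
  ... | tri< m<n _ _ = ⊥-elim (n-min m<n (Equivalence.to P⇔Q pm))
  ... | tri≈ _ m≡n _ = m≡n
  ... | tri> _ _ n<m = ⊥-elim (m-min n<m (Equivalence.from P⇔Q qn))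

  DifferenceClosed : Pred ℕ 0ℓ → Set
  DifferenceClosed P = ∀ m r → P m → P (m + r) → P r

  record Generator (P : Pred ℕ 0ℓ) (m : ℕ) : Set where
    field
      nonZero : NonZero m
      member  : P m
      ∣member : ∀ {d} → P d → m ∣ d

  module _ {P : Pred ℕ 0ℓ} (P? : Decidable P) (closed : DifferenceClosed P) where

    private
      remove-multiples : ∀ {m} r q → P m → P (r + q * m) → P r
      remove-multiples {m} r zero pm p = subst P (+-identityʳ r) p
      remove-multiples {m} r (suc q) pm p = remove-multiples r q pm (closed m (r + q * m) pm (subst P shuffle p))
        where
        shuffle : r + (m + q * m) ≡ m + (r + q * m)
        shuffle = trans (sym (+-assoc r m _)) (trans (cong (_+ q * m) (+-comm r m)) (+-assoc m r _))

    generator : ∃[ n ] P (suc n) → ∃ (Generator P)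
    generator (_ , p) with least (λ t → P? (suc t)) p
    ... | t , pm , minimal = suc t , record { nonZero = _ ; member = pm ; ∣member = ∣member }
      where
      ∣member : ∀ {d} → P d → suc t ∣ d
      ∣member {d} pd = m%n≡0⇒n∣m d (suc t) (remainder-zero (d % suc t) (m%n<n d (suc t)) pr)
        where
        pr : P (d % suc t)
        pr = remove-multiples (d % suc t) (d / suc t) pm (subst P (m≡m%n+[m/n]*n d (suc t)) pd)
        remainder-zero : ∀ r → r < suc t → P r → r ≡ 0
        remainder-zero zero _ _ = refl
        remainder-zero (suc r) (s≤s r<t) pr′ = ⊥-elim (minimal r<t pr′)

open LeastElements

_⇔?_ : {A B : Set} → Dec A → Dec B → Dec (A ⇔ B)
a? ⇔? b? = map′ (uncurry mk⇔) (λ e → Equivalence.to e , Equivalence.from e) ((a? →-dec b?) ×-dec (b? →-dec a?))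

subset : ∀ {n} {P : Pred (Fin n) 0ℓ} → Decidable P → Subset n
subset P? = Vec.tabulate (does ∘ P?)

dec-true⁻¹ : {A : Set} (a? : Dec A) → does a? ≡ true → A
dec-true⁻¹ (yes a) _ = a

∈-subset : ∀ {n} {P : Pred (Fin n) 0ℓ} (P? : Decidable P) x → x ∈ subset P? ⇔ P x
∈-subset P? x = mk⇔
  (λ x∈ → dec-true⁻¹ (P? x) (trans (sym (Vec.lookup∘tabulate (does ∘ P?) x)) (Vec.[]=⇒lookup x∈)))
  (λ p → Vec.lookup⇒[]= x _ (trans (Vec.lookup∘tabulate (does ∘ P?) x) (dec-true (P? x) p)))

module FinGroupProperties (G : FinGroup) where

  open import Algebra.Bundles using (Group)
  open import Algebra.Structures using (IsGroup)
  import Algebra.Properties.Group as GroupProperties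
  open import Data.Nat using (_+_; _*_)
  open import Data.Nat.Properties using (+-comm; *-comm; *-suc; *-zeroʳ; +-suc; m+[n∸m]≡n; n<1+n; anyUpTo?)

  open FinGroup G public
  open IsGroup isGroup public using (assoc; identityˡ; identityʳ; inverseˡ; inverseʳ)

  group : Group 0ℓ 0ℓ
  group = record { Carrier = El G ; _≈_ = _≡_ ; _∙_ = _∙_ ; ε = ε ; _⁻¹ = _⁻¹ ; isGroup = isGroup }

  open GroupProperties group public
    using (identityʳ-unique; ⁻¹-involutive; ⁻¹-anti-homo-∙; \\-leftDividesʳ; //-rightDividesˡ)
  open ≡-Reasoning

  pow-+ : ∀ g i j → pow G g (i + j) ≡ pow G g i ∙ pow G g j
  pow-+ g zero    j = sym (identityˡ _)
  pow-+ g (suc i) j = trans (cong (g ∙_) (pow-+ g i j)) (sym (assoc _ _ _))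

  pow-sucʳ : ∀ g k → pow G g (suc k) ≡ pow G g k ∙ g
  pow-sucʳ g k = begin
    pow G g (suc k)      ≡⟨ cong (pow G g) (+-comm 1 k) ⟩
    pow G g (k + 1)      ≡⟨ pow-+ g k 1 ⟩
    pow G g k ∙ (g ∙ ε)  ≡⟨ cong (pow G g k ∙_) (identityʳ g) ⟩
    pow G g k ∙ g        ∎

  pow-ε : ∀ k → pow G ε k ≡ ε
  pow-ε zero    = refl
  pow-ε (suc k) = trans (identityˡ _) (pow-ε k)

  pow-* : ∀ g i j → pow G g (i * j) ≡ pow G (pow G g i) j
  pow-* g i zero    = cong (pow G g) (*-zeroʳ i)
  pow-* g i (suc j) = begin
    pow G g (i * suc j)              ≡⟨ cong (pow G g) (*-suc i j) ⟩
    pow G g (i + i * j)              ≡⟨ pow-+ g i (i * j) ⟩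
    pow G g i ∙ pow G g (i * j)      ≡⟨ cong (pow G g i ∙_) (pow-* g i j) ⟩
    pow G g i ∙ pow G (pow G g i) j  ∎

  pow-∸ : ∀ g {p q} → q ≤ p → pow G g p ≡ pow G g q ∙ pow G g (p ∸ q)
  pow-∸ g {p} {q} q≤p = trans (cong (pow G g) (sym (m+[n∸m]≡n q≤p))) (pow-+ g q (p ∸ q))

  pow-periodic : ∀ {g n} → pow G g n ≡ ε → ∀ r q → pow G g (r + q * n) ≡ pow G g r
  pow-periodic {g} {n} gⁿ≡ε r q = begin
    pow G g (r + q * n)             ≡⟨ pow-+ g r (q * n) ⟩
    pow G g r ∙ pow G g (q * n)     ≡⟨ cong (λ e → pow G g r ∙ pow G g e) (*-comm q n) ⟩
    pow G g r ∙ pow G g (n * q)     ≡⟨ cong (pow G g r ∙_) (pow-* g n q) ⟩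
    pow G g r ∙ pow G (pow G g n) q ≡⟨ cong (λ h → pow G g r ∙ pow G h q) gⁿ≡ε ⟩
    pow G g r ∙ pow G ε q           ≡⟨ cong (pow G g r ∙_) (pow-ε q) ⟩
    pow G g r ∙ ε                   ≡⟨ identityʳ _ ⟩
    pow G g r                       ∎

  pow-% : ∀ {g n} .{{_ : NonZero n}} → pow G g n ≡ ε → ∀ k → pow G g k ≡ pow G g (k % n)
  pow-% {g} {n} gⁿ≡ε k =
    trans (cong (pow G g) (m≡m%n+[m/n]*n k n)) (pow-periodic gⁿ≡ε (k % n) (k / n))

  conj : El G → El G → El G
  conj x a = x ∙ a ∙ x ⁻¹

  conj-∙-self : ∀ x a → conj x a ∙ x ≡ x ∙ a
  conj-∙-self x a = trans (assoc _ _ _) (trans (cong (x ∙ a ∙_) (inverseˡ x)) (identityʳ _))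

  ∙⁻¹∙conj : ∀ x y a → y ∙ x ⁻¹ ∙ conj x a ≡ y ∙ a ∙ x ⁻¹
  ∙⁻¹∙conj x y a = begin
    (y ∙ x ⁻¹) ∙ (x ∙ a ∙ x ⁻¹) ≡⟨ assoc _ _ _ ⟩
    y ∙ (x ⁻¹ ∙ (x ∙ a ∙ x ⁻¹)) ≡⟨ cong (y ∙_) (sym (assoc _ _ _)) ⟩
    y ∙ (x ⁻¹ ∙ (x ∙ a) ∙ x ⁻¹) ≡⟨ cong (λ t → y ∙ (t ∙ x ⁻¹)) (\\-leftDividesʳ x a) ⟩
    y ∙ (a ∙ x ⁻¹)              ≡⟨ sym (assoc _ _ _) ⟩
    y ∙ a ∙ x ⁻¹                ∎

  conj-∙ : ∀ x a b → conj x a ∙ conj x b ≡ conj x (a ∙ b)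
  conj-∙ x a b = trans (∙⁻¹∙conj x (x ∙ a) b) (cong (_∙ x ⁻¹) (assoc x a b))

  conj-ε : ∀ x → conj x ε ≡ ε
  conj-ε x = trans (cong (_∙ x ⁻¹) (identityʳ x)) (inverseʳ x)

  pow-conj : ∀ x g k → pow G (conj x g) k ≡ conj x (pow G g k)
  pow-conj x g zero    = sym (conj-ε x)
  pow-conj x g (suc k) = trans (cong (conj x g ∙_) (pow-conj x g k)) (conj-∙ x g (pow G g k))

  pow-order-exists : ∀ g → ∃[ n ] pow G g (suc n) ≡ ε
  pow-order-exists g with Fin.pigeonhole (n<1+n order) (λ (i : Fin (suc order)) → pow G g (toℕ i))
  ... | i , j , i<j , gⁱ≡gʲ = d , identityʳ-unique (pow G g (toℕ i)) _ gⁱ⁺ᵈ⁺¹≡gⁱ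
    where
    d : ℕ
    d = toℕ j ∸ suc (toℕ i)
    gⁱ⁺ᵈ⁺¹≡gⁱ : pow G g (toℕ i) ∙ pow G g (suc d) ≡ pow G g (toℕ i)
    gⁱ⁺ᵈ⁺¹≡gⁱ = begin
      pow G g (toℕ i) ∙ pow G g (suc d) ≡⟨ pow-+ g (toℕ i) (suc d) ⟨
      pow G g (toℕ i + suc d)           ≡⟨ cong (pow G g) (trans (+-suc (toℕ i) d) (m+[n∸m]≡n i<j)) ⟩
      pow G g (toℕ j)                   ≡⟨ gⁱ≡gʲ ⟨
      pow G g (toℕ i)                   ∎

  pow≡ε-differenceClosed : ∀ g → DifferenceClosed (λ d → pow G g d ≡ ε)
  pow≡ε-differenceClosed g m r gᵐ≡ε gᵐ⁺ʳ≡ε = begin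
    pow G g r             ≡⟨ identityˡ _ ⟨
    ε ∙ pow G g r         ≡⟨ cong (_∙ pow G g r) gᵐ≡ε ⟨
    pow G g m ∙ pow G g r ≡⟨ pow-+ g m r ⟨
    pow G g (m + r)       ≡⟨ gᵐ⁺ʳ≡ε ⟩
    ε                     ∎

  private
    order-generator : ∀ g → ∃ (Generator (λ d → pow G g d ≡ ε))
    order-generator g =
      generator (λ d → pow G g d Fin.≟ ε) (pow≡ε-differenceClosed g) (pow-order-exists g)

  abstract
    ord : El G → ℕ
    ord g = proj₁ (order-generator g)

    ord-generator : ∀ g → Generator (λ d → pow G g d ≡ ε) (ord g)
    ord-generator g = proj₂ (order-generator g)

  instance
    ord-nonZero : ∀ {g} → NonZero (ord g)
    ord-nonZero {g} = Generator.nonZero (ord-generator g)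

  pow-ord : ∀ g → pow G g (ord g) ≡ ε
  pow-ord g = Generator.member (ord-generator g)

  ord-∣ : ∀ {g d} → pow G g d ≡ ε → ord g ∣ d
  ord-∣ {g} = Generator.∣member (ord-generator g)

  pow-≡⇒≡+*ord : ∀ {g p q} → q ≤ p → pow G g p ≡ pow G g q → ∃[ c ] p ≡ q + c * ord g
  pow-≡⇒≡+*ord {g} {p} {q} q≤p gᵖ≡gᑫ with ord-∣ gᵖ⁻ᑫ≡ε
    where
    gᵖ⁻ᑫ≡ε : pow G g (p ∸ q) ≡ ε
    gᵖ⁻ᑫ≡ε = identityʳ-unique (pow G g q) _ (trans (sym (pow-∸ g q≤p)) gᵖ≡gᑫ)
  ... | divides c p∸q≡c*ord = c , trans (sym (m+[n∸m]≡n q≤p)) (cong (q +_) p∸q≡c*ord)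

  powerOf? : ∀ g x → Dec (∃[ k ] x ≡ pow G g k)
  powerOf? g x with anyUpTo? (λ k → x Fin.≟ pow G g k) (ord g)
  ... | yes (k , _ , x≡gᵏ) = yes (k , x≡gᵏ)
  ... | no none = no λ (k , x≡gᵏ) →
    none (k % ord g , m%n<n k (ord g) , trans x≡gᵏ (pow-% (pow-ord g) k))

  isCyclic? : ∀ S → Dec (IsCyclic G S)
  isCyclic? S = Fin.any? (λ g → Fin.all? (λ x → (x ∈? S) ⇔? powerOf? g x))

  ⟨_⟩ : El G → Subset order
  ⟨ g ⟩ = subset (powerOf? g)

  ⟨⟩-isCyclic : ∀ g → IsCyclic G ⟨ g ⟩
  ⟨⟩-isCyclic g = g , ∈-subset (powerOf? g)

  pow∈⟨⟩ : ∀ g k → pow G g k ∈ ⟨ g ⟩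
  pow∈⟨⟩ g k = Equivalence.from (∈-subset (powerOf? g) _) (k , refl)

  module Subgroup {S : Subset order} (S-sub : IsSubgroup G S) where

    open IsSubgroup S-sub public

    pow∈ : ∀ {g} k → g ∈ S → pow G g k ∈ S
    pow∈ zero    g∈S = ε∈
    pow∈ (suc k) g∈S = ∙∈ g∈S (pow∈ k g∈S)

    ∙⁻¹∈ : ∀ {a h} → a ∈ S → h ∈ S → a ∙ h ⁻¹ ∈ S
    ∙⁻¹∈ a∈S h∈S = ∙∈ a∈S (⁻¹∈ h∈S)

    ∙⁻¹∈⇒∈ : ∀ {a h} → h ∈ S → a ∙ h ⁻¹ ∈ S → a ∈ S
    ∙⁻¹∈⇒∈ {a} {h} h∈S ah⁻¹∈S = subst (_∈ S) (//-rightDividesˡ h a) (∙∈ ah⁻¹∈S h∈S)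

    ∙⁻¹∈-sym : ∀ {a b} → a ∙ b ⁻¹ ∈ S → b ∙ a ⁻¹ ∈ S
    ∙⁻¹∈-sym {a} {b} ab⁻¹∈S = subst (_∈ S) flip (⁻¹∈ ab⁻¹∈S)
      where
      flip : (a ∙ b ⁻¹) ⁻¹ ≡ b ∙ a ⁻¹
      flip = trans (⁻¹-anti-homo-∙ a (b ⁻¹)) (cong (_∙ a ⁻¹) (⁻¹-involutive b))

    same-coset : ∀ {a u v} → a ∙ u ⁻¹ ∈ S → a ∙ v ⁻¹ ∈ S → u ∙ v ⁻¹ ∈ S
    same-coset {a} {u} {v} au⁻¹∈S av⁻¹∈S = subst (_∈ S) cancel (∙∈ (∙⁻¹∈-sym au⁻¹∈S) av⁻¹∈S)
      where
      cancel : u ∙ a ⁻¹ ∙ (a ∙ v ⁻¹) ≡ u ∙ v ⁻¹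
      cancel = trans (assoc _ _ _) (cong (u ∙_) (\\-leftDividesʳ a (v ⁻¹)))

    conj-pow∈-differenceClosed : ∀ x g → DifferenceClosed (λ d → conj x (pow G g d) ∈ S)
    conj-pow∈-differenceClosed x g m r gᵐ∈ gᵐ⁺ʳ∈ = subst (_∈ S) cancel (∙∈ (⁻¹∈ gᵐ∈) gᵐ⁺ʳ∈)
      where
      cancel : conj x (pow G g m) ⁻¹ ∙ conj x (pow G g (m + r)) ≡ conj x (pow G g r)
      cancel = trans (cong (λ a → conj x (pow G g m) ⁻¹ ∙ a)
                       (trans (cong (conj x) (pow-+ g m r)) (sym (conj-∙ x (pow G g m) (pow G g r)))))
                     (\\-leftDividesʳ (conj x (pow G g m)) (conj x (pow G g r)))

    ⟨⟩⊆ : ∀ {g} → g ∈ S → ⟨ g ⟩ ⊆ S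
    ⟨⟩⊆ {g} g∈S {x} x∈⟨g⟩ with Equivalence.to (∈-subset (powerOf? g) x) x∈⟨g⟩
    ... | k , x≡gᵏ = subst (_∈ S) (sym x≡gᵏ) (pow∈ k g∈S)

module IntegerSums where

  open import Data.Integer using (_+_; _-_; -_; _*_)
  open import Data.Integer.Properties
    using (i-j≡0⇒i≡j; i≡j⇒i-j≡0; +-identityˡ; +-identityʳ; +-assoc; neg-distrib-+; *-zeroʳ; *-zeroˡ; *-distribˡ-+)
  open import Data.Integer.Tactic.RingSolver using (solve-∀)

  ≡-from-difference : ∀ {L R X Y : ℤ} → X ≡ Y → L - R ≡ X - Y → L ≡ R
  ≡-from-difference {L} {R} X≡Y L-R≡X-Y = i-j≡0⇒i≡j L R (trans L-R≡X-Y (i≡j⇒i-j≡0 X≡Y))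

  ∑ : ℕ → (ℕ → ℤ) → ℤ
  ∑ zero    F = 0ℤ
  ∑ (suc n) F = F 0 + ∑ n (F ∘ suc)

  open ≡-Reasoning

  ∑-cong< : ∀ n {F G : ℕ → ℤ} → (∀ {k} → k < n → F k ≡ G k) → ∑ n F ≡ ∑ n G
  ∑-cong< zero    F≡G = refl
  ∑-cong< (suc n) F≡G = cong₂ _+_ (F≡G (s≤s z≤n)) (∑-cong< n (F≡G ∘ s≤s))

  ∑-cong : ∀ n {F G : ℕ → ℤ} → (∀ k → F k ≡ G k) → ∑ n F ≡ ∑ n G
  ∑-cong n F≡G = ∑-cong< n (λ {k} _ → F≡G k)

  ∑-+ : ∀ n F G → ∑ n (λ k → F k + G k) ≡ ∑ n F + ∑ n G
  ∑-+ zero    F G = refl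
  ∑-+ (suc n) F G = trans (cong ((F 0 + G 0) +_) (∑-+ n (F ∘ suc) (G ∘ suc))) (interchange (F 0) (G 0) (∑ n (F ∘ suc)) (∑ n (G ∘ suc)))
    where
    interchange : ∀ a b c d → (a + b) + (c + d) ≡ (a + c) + (b + d)
    interchange = solve-∀

  ∑-neg : ∀ n F → ∑ n (λ k → - F k) ≡ - ∑ n F
  ∑-neg zero    F = refl
  ∑-neg (suc n) F = trans (cong ((- F 0) +_) (∑-neg n (F ∘ suc))) (sym (neg-distrib-+ (F 0) _))

  ∑-- : ∀ n F G → ∑ n (λ k → F k - G k) ≡ ∑ n F - ∑ n G
  ∑-- n F G = trans (∑-+ n F (λ k → - G k)) (cong (∑ n F +_) (∑-neg n G))

  ∑-* : ∀ n c F → ∑ n (λ k → c * F k) ≡ c * ∑ n F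
  ∑-* zero    c F = sym (*-zeroʳ c)
  ∑-* (suc n) c F = trans (cong ((c * F 0) +_) (∑-* n c (F ∘ suc))) (sym (*-distribˡ-+ c (F 0) _))

  ∑-const : ∀ n c → ∑ n (λ _ → c) ≡ ℤ.+ n * c
  ∑-const zero    c = sym (*-zeroˡ c)
  ∑-const (suc n) c = trans (cong (c +_) (∑-const n c)) (suc-* c (ℤ.+ n))
    where
    suc-* : ∀ c m → c + m * c ≡ (1ℤ + m) * c
    suc-* = solve-∀

  ∑-zero : ∀ n → ∑ n (λ _ → 0ℤ) ≡ 0ℤ
  ∑-zero n = trans (∑-const n 0ℤ) (*-zeroʳ (ℤ.+ n))

  ∑-split : ∀ a b F → ∑ (a ℕ.+ b) F ≡ ∑ a F + ∑ b (λ k → F (a ℕ.+ k))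
  ∑-split zero    b F = sym (+-identityˡ _)
  ∑-split (suc a) b F = trans (cong (F 0 +_) (∑-split a b (F ∘ suc))) (sym (+-assoc (F 0) _ _))

  ∑-last : ∀ n F → ∑ (suc n) F ≡ ∑ n F + F n
  ∑-last n F = begin
    ∑ (suc n) F                    ≡⟨ cong (λ m → ∑ m F) (ℕ.+-comm 1 n) ⟩
    ∑ (n ℕ.+ 1) F                  ≡⟨ ∑-split n 1 F ⟩
    ∑ n F + (F (n ℕ.+ 0) + 0ℤ)     ≡⟨ cong (∑ n F +_) (trans (+-identityʳ _) (cong F (ℕ.+-identityʳ n))) ⟩
    ∑ n F + F n                    ∎

  ∑-telescope : ∀ n T → ∑ n (λ k → T k - T (suc k)) ≡ T 0 - T n
  ∑-telescope zero    T = sym (i≡j⇒i-j≡0 {T 0} refl)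
  ∑-telescope (suc n) T = trans (cong ((T 0 - T 1) +_) (∑-telescope n (λ k → T (suc k)))) (collapse (T 0) (T 1) (T (suc n)))
    where
    collapse : ∀ a b c → (a - b) + (b - c) ≡ a - c
    collapse = solve-∀

  ∑-double : ∀ a b F → ∑ (a ℕ.* b) F ≡ ∑ a (λ t → ∑ b (λ u → F (t ℕ.+ a ℕ.* u)))
  ∑-double a zero    F = trans (cong (λ m → ∑ m F) (ℕ.*-zeroʳ a)) (sym (∑-zero a))
  ∑-double a (suc b) F = begin
    ∑ (a ℕ.* suc b) F
      ≡⟨ cong (λ m → ∑ m F) (ℕ.*-suc a b) ⟩
    ∑ (a ℕ.+ a ℕ.* b) F
      ≡⟨ ∑-split a (a ℕ.* b) F ⟩
    ∑ a F + ∑ (a ℕ.* b) (λ k → F (a ℕ.+ k))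
      ≡⟨ cong (∑ a F +_) (∑-double a b (λ k → F (a ℕ.+ k))) ⟩
    ∑ a F + ∑ a (λ t → ∑ b (λ u → F (a ℕ.+ (t ℕ.+ a ℕ.* u))))
      ≡⟨ ∑-+ a F _ ⟨
    ∑ a (λ t → F t + ∑ b (λ u → F (a ℕ.+ (t ℕ.+ a ℕ.* u))))
      ≡⟨ ∑-cong a (λ t → cong₂ _+_ (cong F (first t)) (∑-cong b (λ u → cong F (shift t u)))) ⟩
    ∑ a (λ t → ∑ (suc b) (λ u → F (t ℕ.+ a ℕ.* u)))
      ∎
    where
    first : ∀ t → t ≡ t ℕ.+ a ℕ.* 0
    first t = sym (trans (cong (t ℕ.+_) (ℕ.*-zeroʳ a)) (ℕ.+-identityʳ t))
    shift : ∀ t u → a ℕ.+ (t ℕ.+ a ℕ.* u) ≡ t ℕ.+ a ℕ.* suc u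
    shift t u = begin
      a ℕ.+ (t ℕ.+ a ℕ.* u) ≡⟨ ℕ.+-assoc a t _ ⟨
      a ℕ.+ t ℕ.+ a ℕ.* u   ≡⟨ cong (ℕ._+ a ℕ.* u) (ℕ.+-comm a t) ⟩
      t ℕ.+ a ℕ.+ a ℕ.* u   ≡⟨ ℕ.+-assoc t a _ ⟩
      t ℕ.+ (a ℕ.+ a ℕ.* u) ≡⟨ cong (t ℕ.+_) (ℕ.*-suc a u) ⟨
      t ℕ.+ a ℕ.* suc u     ∎

  ∑-single : ∀ n {j} F → j < n → (∀ {k} → k < n → k ≢ j → F k ≡ 0ℤ) → ∑ n F ≡ F j
  ∑-single (suc n) {zero} F _ others = begin
    F 0 + ∑ n (F ∘ suc)           ≡⟨ cong (F 0 +_) (∑-cong< n (λ k<n → others (s≤s k<n) λ ())) ⟩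
    F 0 + ∑ n (λ _ → 0ℤ)          ≡⟨ cong (F 0 +_) (∑-zero n) ⟩
    F 0 + 0ℤ                      ≡⟨ +-identityʳ (F 0) ⟩
    F 0                           ∎
  ∑-single (suc n) {suc j} F (s≤s j<n) others = begin
    F 0 + ∑ n (F ∘ suc)           ≡⟨ cong (_+ ∑ n (F ∘ suc)) (others (s≤s z≤n) λ ()) ⟩
    0ℤ + ∑ n (F ∘ suc)            ≡⟨ +-identityˡ _ ⟩
    ∑ n (F ∘ suc)                 ≡⟨ ∑-single n (F ∘ suc) j<n (λ k<n k≢j → others (s≤s k<n) (k≢j ∘ ℕ.suc-injective)) ⟩
    F (suc j)                     ∎

open IntegerSums

module Coefficients (G : FinGroup) (ℋ : List (Subset (FinGroup.order G))) where

  open import Data.Integer using (_+_; _-_; -_; _*_)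
  open import Data.Integer.Properties using (+-identityʳ; *-distribˡ-+; *-zeroˡ; i*j≡0⇒i≡0∨j≡0; +-injective)
  open import Data.Integer.Tactic.RingSolver using (solve-∀)
  open import Relation.Binary.Bundles using (Setoid)
  import Relation.Binary.Reasoning.Setoid as SetoidReasoning

  open FinGroupProperties G

  infixl 6 _⊞_ _⊟_
  infixr 7 _▸_ _·_
  infix 4 _≈_ _≐_

  _⊞_ _⊟_ : Raw G ℋ → Raw G ℋ → Raw G ℋ
  _⊞_ = _⊕_ G ℋ
  _⊟_ = _⊖_ G ℋ

  _▸_ : El G → Raw G ℋ → Raw G ℋ
  _▸_ = act G ℋ

  _·_ : ℤ → Raw G ℋ → Raw G ℋ
  (c · φ) i x = c * φ i x

  ∑ᴿ : ℕ → (ℕ → Raw G ℋ) → Raw G ℋ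
  ∑ᴿ n Φ i x = ∑ n (λ k → Φ k i x)

  norm : El G → ℕ → Raw G ℋ → Raw G ℋ
  norm g s φ = ∑ᴿ s (λ k → pow G g k ▸ φ)

  coboundary : (El G → Raw G ℋ) → El G → El G → Raw G ℋ
  coboundary u a b = (a ▸ u b ⊟ u (a ∙ b)) ⊞ u a

  _≐_ : Raw G ℋ → Raw G ℋ → Set
  φ ≐ ψ = ∀ i x → φ i x ≡ ψ i x

  -- Equality in J, wrapped in a record so that both sides can be inferred from a proof.
  record _≈_ (φ ψ : Raw G ℋ) : Set where
    constructor ⟪_⟫
    field un : _≈J_ G ℋ φ ψ
  open _≈_ public

  ≐⇒≈ : ∀ {φ ψ} → φ ≐ ψ → φ ≈ ψ
  ≐⇒≈ φ≐ψ = ⟪ 0ℤ , (λ i x → trans (φ≐ψ i x) (sym (+-identityʳ _))) ⟫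

  ≈-refl : ∀ {φ} → φ ≈ φ
  ≈-refl = ≐⇒≈ (λ _ _ → refl)

  ≈-sym : ∀ {φ ψ} → φ ≈ ψ → ψ ≈ φ
  ≈-sym {φ} {ψ} ⟪ c , φ≡ψ+c ⟫ =
    ⟪ - c , (λ i x → ≡-from-difference (sym (φ≡ψ+c i x)) (rearrange (φ i x) (ψ i x) c)) ⟫
    where
    rearrange : ∀ a b c → b - (a + - c) ≡ (b + c) - a
    rearrange = solve-∀

  ≈-trans : ∀ {φ ψ χ} → φ ≈ ψ → ψ ≈ χ → φ ≈ χ
  ≈-trans {φ} {ψ} {χ} ⟪ c , φ≡ψ+c ⟫ ⟪ d , ψ≡χ+d ⟫ =
    ⟪ d + c , (λ i x → ≡-from-difference (cong₂ _+_ (φ≡ψ+c i x) (ψ≡χ+d i x)) (rearrange (φ i x) (ψ i x) (χ i x) c d)) ⟫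
    where
    rearrange : ∀ a b m c d → a - (m + (d + c)) ≡ (a + b) - ((b + c) + (m + d))
    rearrange = solve-∀

  J-setoid : Setoid 0ℓ 0ℓ
  J-setoid = record
    { Carrier = Raw G ℋ ; _≈_ = _≈_
    ; isEquivalence = record { refl = ≈-refl ; sym = ≈-sym ; trans = ≈-trans } }

  module ≈-Reasoning = SetoidReasoning J-setoid

  ⊞-cong : ∀ {φ φ′ ψ ψ′} → φ ≈ φ′ → ψ ≈ ψ′ → φ ⊞ ψ ≈ φ′ ⊞ ψ′
  ⊞-cong {φ} {φ′} {ψ} {ψ′} ⟪ c , e ⟫ ⟪ d , e′ ⟫ =
    ⟪ c + d , (λ i x → ≡-from-difference (cong₂ _+_ (e i x) (e′ i x)) (rearrange (φ i x) (φ′ i x) (ψ i x) (ψ′ i x) c d)) ⟫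
    where
    rearrange : ∀ a a′ b b′ c d → (a + b) - ((a′ + b′) + (c + d)) ≡ (a + b) - ((a′ + c) + (b′ + d))
    rearrange = solve-∀

  ⊟-cong : ∀ {φ φ′ ψ ψ′} → φ ≈ φ′ → ψ ≈ ψ′ → φ ⊟ ψ ≈ φ′ ⊟ ψ′
  ⊟-cong {φ} {φ′} {ψ} {ψ′} ⟪ c , e ⟫ ⟪ d , e′ ⟫ =
    ⟪ c - d , (λ i x → ≡-from-difference (cong₂ _-_ (e i x) (e′ i x)) (rearrange (φ i x) (φ′ i x) (ψ i x) (ψ′ i x) c d)) ⟫
    where
    rearrange : ∀ a a′ b b′ c d → (a - b) - ((a′ - b′) + (c - d)) ≡ (a - b) - ((a′ + c) - (b′ + d))
    rearrange = solve-∀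

  ▸-cong : ∀ g {φ ψ} → φ ≈ ψ → g ▸ φ ≈ g ▸ ψ
  ▸-cong g ⟪ c , e ⟫ = ⟪ c , (λ i x → e i (x ∙ g)) ⟫

  ·-cong : ∀ z {φ ψ} → φ ≈ ψ → z · φ ≈ z · ψ
  ·-cong z ⟪ c , e ⟫ = ⟪ z * c , (λ i x → trans (cong (z *_) (e i x)) (*-distribˡ-+ z _ c)) ⟫

  ∑ᴿ-cong : ∀ n {Φ Ψ} → (∀ {k} → k < n → Φ k ≈ Ψ k) → ∑ᴿ n Φ ≈ ∑ᴿ n Ψ
  ∑ᴿ-cong zero    Φ≈Ψ = ≈-refl
  ∑ᴿ-cong (suc n) Φ≈Ψ = ⊞-cong (Φ≈Ψ (s≤s z≤n)) (∑ᴿ-cong n (Φ≈Ψ ∘ s≤s))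

  norm-cong : ∀ g s {φ ψ} → φ ≈ ψ → norm g s φ ≈ norm g s ψ
  norm-cong g s φ≈ψ = ∑ᴿ-cong s (λ {k} _ → ▸-cong (pow G g k) φ≈ψ)

  ⊞-isolateˡ : ∀ {φ ψ χ} → φ ≈ ψ ⊞ χ → ψ ≈ φ ⊟ χ
  ⊞-isolateˡ {φ} {ψ} {χ} ⟪ c , e ⟫ =
    ⟪ - c , (λ i x → ≡-from-difference (sym (e i x)) (rearrange (φ i x) (ψ i x) (χ i x) c)) ⟫
    where
    rearrange : ∀ a b d c → b - ((a - d) + - c) ≡ ((b + d) + c) - a
    rearrange = solve-∀

  ⊞-isolateʳ : ∀ {φ ψ χ} → φ ≈ ψ ⊞ χ → χ ≈ φ ⊟ ψ
  ⊞-isolateʳ {φ} {ψ} {χ} ⟪ c , e ⟫ =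
    ⟪ - c , (λ i x → ≡-from-difference (sym (e i x)) (rearrange (φ i x) (ψ i x) (χ i x) c)) ⟫
    where
    rearrange : ∀ a b d c → d - ((a - b) + - c) ≡ ((b + d) + c) - a
    rearrange = solve-∀

  InSum-⊞ : ∀ {φ ψ} → InSum G ℋ φ → InSum G ℋ ψ → InSum G ℋ (φ ⊞ ψ)
  InSum-⊞ p q i h x h∈ = cong₂ _+_ (p i h x h∈) (q i h x h∈)

  InSum-⊟ : ∀ {φ ψ} → InSum G ℋ φ → InSum G ℋ ψ → InSum G ℋ (φ ⊟ ψ)
  InSum-⊟ p q i h x h∈ = cong₂ _-_ (p i h x h∈) (q i h x h∈)

  InSum-▸ : ∀ g {φ} → InSum G ℋ φ → InSum G ℋ (g ▸ φ)
  InSum-▸ g {φ} p i h x h∈ = trans (cong (φ i) (assoc h x g)) (p i h (x ∙ g) h∈)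

  InSum-· : ∀ c {φ} → InSum G ℋ φ → InSum G ℋ (c · φ)
  InSum-· c p i h x h∈ = cong (c *_) (p i h x h∈)

  InSum-∑ᴿ : ∀ n {Φ} → (∀ k → InSum G ℋ (Φ k)) → InSum G ℋ (∑ᴿ n Φ)
  InSum-∑ᴿ n p i h x h∈ = ∑-cong n (λ k → p k i h x h∈)

  InSum-norm : ∀ g s {φ} → InSum G ℋ φ → InSum G ℋ (norm g s φ)
  InSum-norm g s p = InSum-∑ᴿ s (λ k → InSum-▸ (pow G g k) p)

  norm-⊟ : ∀ g s φ ψ → norm g s (φ ⊟ ψ) ≐ norm g s φ ⊟ norm g s ψ
  norm-⊟ g s φ ψ i y = ∑-- s (λ k → φ i (y ∙ pow G g k)) (λ k → ψ i (y ∙ pow G g k))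

  norm-· : ∀ g s z φ → norm g s (z · φ) ≐ z · norm g s φ
  norm-· g s z φ i y = ∑-* s z (λ k → φ i (y ∙ pow G g k))

  norm-+ : ∀ g i j φ → norm g (i ℕ.+ j) φ ≐ norm g i φ ⊞ pow G g i ▸ norm g j φ
  norm-+ g i j φ y x = trans (∑-split i j (λ t → φ y (x ∙ pow G g t)))
    (cong (norm g i φ y x +_) (∑-cong j (λ t → cong (φ y) (trans (cong (x ∙_) (pow-+ g i t)) (sym (assoc _ _ _))))))

  norm-split : ∀ g e s φ → norm g (e ℕ.* s) φ ≐ norm g e (norm (pow G g e) s φ)
  norm-split g e s φ i y = begin
    ∑ (e ℕ.* s) (λ k → φ i (y ∙ pow G g k))
      ≡⟨ ∑-double e s _ ⟩
    ∑ e (λ t → ∑ s (λ v → φ i (y ∙ pow G g (t ℕ.+ e ℕ.* v))))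
      ≡⟨ ∑-cong e (λ t → ∑-cong s (λ v → cong (φ i) (regroup t v))) ⟩
    ∑ e (λ t → ∑ s (λ v → φ i (y ∙ pow G g t ∙ pow G (pow G g e) v)))
      ∎
    where
    open ≡-Reasoning
    regroup : ∀ t v → y ∙ pow G g (t ℕ.+ e ℕ.* v) ≡ y ∙ pow G g t ∙ pow G (pow G g e) v
    regroup t v = trans (cong (y ∙_) (trans (pow-+ g t (e ℕ.* v)) (cong (pow G g t ∙_) (pow-* g e v)))) (sym (assoc _ _ _))

  norm-fixed : ∀ g e φ → (∀ k i x → φ i (x ∙ pow G g k) ≡ φ i x) → norm g e φ ≐ ℤ.+ e · φ
  norm-fixed g e φ fixed i x = trans (∑-cong e (λ k → fixed k i x)) (∑-const e (φ i x))

  ▸-norm-conj : ∀ x g s φ → x ⁻¹ ▸ norm (conj x g) s φ ≐ norm g s (x ⁻¹ ▸ φ)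
  ▸-norm-conj x g s φ i y = ∑-cong s (λ k →
    cong (φ i) (trans (cong (y ∙ x ⁻¹ ∙_) (pow-conj x g k)) (∙⁻¹∙conj x y (pow G g k))))

  ∑-coboundary : ∀ g s v → pow G g s ≡ ε → ∑ᴿ s (λ k → coboundary v (pow G g k) g) ≐ norm g s (v g)
  ∑-coboundary g s v gˢ≡ε i x = begin
    ∑ s (λ k → (v g i (x ∙ gᵏ k) - v (gᵏ k ∙ g) i x) + v (gᵏ k) i x)
      ≡⟨ ∑-cong s (λ k → cong (λ t → (v g i (x ∙ gᵏ k) - v t i x) + v (gᵏ k) i x) (sym (pow-sucʳ g k))) ⟩
    ∑ s (λ k → (v g i (x ∙ gᵏ k) - V (suc k)) + V k)
      ≡⟨ ∑-cong s (λ k → rearrange (v g i (x ∙ gᵏ k)) (V (suc k)) (V k)) ⟩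
    ∑ s (λ k → v g i (x ∙ gᵏ k) + (V k - V (suc k)))
      ≡⟨ ∑-+ s _ _ ⟩
    norm g s (v g) i x + ∑ s (λ k → V k - V (suc k))
      ≡⟨ cong (norm g s (v g) i x +_) (∑-telescope s V) ⟩
    norm g s (v g) i x + (V 0 - V s)
      ≡⟨ cong (λ t → norm g s (v g) i x + (V 0 - v t i x)) gˢ≡ε ⟩
    norm g s (v g) i x + (V 0 - V 0)
      ≡⟨ cancel (norm g s (v g) i x) (V 0) ⟩
    norm g s (v g) i x ∎
    where
    open ≡-Reasoning
    gᵏ : ℕ → El G
    gᵏ = pow G g
    V : ℕ → ℤ
    V k = v (gᵏ k) i x
    rearrange : ∀ a b c → (a - b) + c ≡ a + (c - b)
    rearrange = solve-∀
    cancel : ∀ a b → a + (b - b) ≡ a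
    cancel = solve-∀

  -- If g shifts φ by the constant c then gⁿ = ε shifts it by n c, so c = 0.
  ▸-fixed : ∀ {g n φ} .{{_ : NonZero n}} → pow G g n ≡ ε → g ▸ φ ≈ φ → ∀ i x → φ i (x ∙ g) ≡ φ i x
  ▸-fixed {g} {n} {φ} gⁿ≡ε ⟪ c , shift ⟫ i x = trans (shift i x) (trans (cong (φ i x +_) c≡0) (+-identityʳ _))
    where
    shift-pow : ∀ k → φ i (x ∙ pow G g k) ≡ φ i x + ℤ.+ k * c
    shift-pow zero    = trans (cong (φ i) (identityʳ x)) (sym (trans (cong (φ i x +_) (*-zeroˡ c)) (+-identityʳ _)))
    shift-pow (suc k) = begin
      φ i (x ∙ pow G g (suc k))     ≡⟨ cong (φ i) (trans (cong (x ∙_) (pow-sucʳ g k)) (sym (assoc _ _ _))) ⟩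
      φ i (x ∙ pow G g k ∙ g)       ≡⟨ shift i _ ⟩
      φ i (x ∙ pow G g k) + c       ≡⟨ cong (_+ c) (shift-pow k) ⟩
      (φ i x + ℤ.+ k * c) + c       ≡⟨ step (φ i x) (ℤ.+ k) c ⟩
      φ i x + (1ℤ + ℤ.+ k) * c      ∎
      where
      open ≡-Reasoning
      step : ∀ a k c → (a + k * c) + c ≡ a + (1ℤ + k) * c
      step = solve-∀
    n*c≡0 : ℤ.+ n * c ≡ 0ℤ
    n*c≡0 = ≡-from-difference (sym (trans (cong (φ i) (sym xgⁿ≡x)) (shift-pow n))) (rearrange (φ i x) (ℤ.+ n * c))
      where
      xgⁿ≡x : x ∙ pow G g n ≡ x
      xgⁿ≡x = trans (cong (x ∙_) gⁿ≡ε) (identityʳ x)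
      rearrange : ∀ a b → b - 0ℤ ≡ (a + b) - a
      rearrange = solve-∀
    c≡0 : c ≡ 0ℤ
    c≡0 with i*j≡0⇒i≡0∨j≡0 (ℤ.+ n) n*c≡0
    ... | inj₁ n≡0 = ⊥-elim (ℕ.≢-nonZero⁻¹ n (+-injective n≡0))
    ... | inj₂ c≡0 = c≡0

module Cocycle (G : FinGroup) (ℋ : List (Subset (FinGroup.order G)))
               (fc : Cochain2 G ℋ) (coc : IsCocycle G ℋ fc) where

  open import Data.Integer using (_+_; _-_; -_)
  open import Data.Integer.Tactic.RingSolver using (solve-∀)

  open FinGroupProperties G
  open Coefficients G ℋ

  f : El G → El G → Raw G ℋ
  f = proj₁ fc

  f-InSum : ∀ a b → InSum G ℋ (f a b)
  f-InSum = proj₂ fc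

  κ : El G → El G → El G → ℤ
  κ a b c = proj₁ (coc a b c)

  cocycle-at : ∀ a b c {ab bc za} i z → a ∙ b ≡ ab → b ∙ c ≡ bc → z ∙ a ≡ za →
               ((f b c i za - f ab c i z) + f a bc i z) - f a b i z ≡ 0ℤ + κ a b c
  cocycle-at a b c i z refl refl refl = proj₂ (coc a b c) i z

  f-ε-right : ∀ a → f a ε ≈ a ▸ f ε ε
  f-ε-right a = ⟪ - κ a ε ε , (λ i z → ≡-from-difference
    (sym (cocycle-at a ε ε i z (identityʳ a) (identityʳ ε) refl))
    (rearrange (f a ε i z) (f ε ε i (z ∙ a)) (κ a ε ε))) ⟫
    where
    rearrange : ∀ fa fε k → fa - (fε + - k) ≡ (0ℤ + k) - (((fε - fa) + fa) - fa)
    rearrange = solve-∀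

  f-ε-left : ∀ c → f ε c ≈ f ε ε
  f-ε-left c = ⟪ κ ε ε c , (λ i z → ≡-from-difference
    (cocycle-at ε ε c i z (identityʳ ε) (identityˡ c) (identityʳ z))
    (rearrange (f ε c i z) (f ε ε i z) (κ ε ε c))) ⟫
    where
    rearrange : ∀ fc fε k → fc - (fε + k) ≡ (((fc - fc) + fc) - fε) - (0ℤ + k)
    rearrange = solve-∀

  cocycle : ∀ a b c → f a (b ∙ c) ≈ (f a b ⊟ a ▸ f b c) ⊞ f (a ∙ b) c
  cocycle a b c = ⟪ κ a b c , (λ i z → ≡-from-difference (cocycle-at a b c i z refl refl refl)
    (rearrange (f b c i (z ∙ a)) (f (a ∙ b) c i z) (f a (b ∙ c) i z) (f a b i z) (κ a b c))) ⟫
    where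
    rearrange : ∀ p q r s k → r - (((s - p) + q) + k) ≡ (((p - q) + r) - s) - (0ℤ + k)
    rearrange = solve-∀

  cyclicClass : El G → ℕ → Raw G ℋ
  cyclicClass g s = ∑ᴿ s (λ k → f (pow G g k) g)

  cyclicClass-InSum : ∀ g s → InSum G ℋ (cyclicClass g s)
  cyclicClass-InSum g s = InSum-∑ᴿ s (λ k → f-InSum (pow G g k) g)

  cyclicClass-coboundary : ∀ g s v → pow G g s ≡ ε →
    (∀ {k} → k < s → f (pow G g k) g ≈ coboundary v (pow G g k) g) → cyclicClass g s ≈ norm g s (v g)
  cyclicClass-coboundary g s v gˢ≡ε f≈∂v = ≈-trans (∑ᴿ-cong s f≈∂v) (≐⇒≈ (∑-coboundary g s v gˢ≡ε))

  module Conjugation (x : El G) where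

    h : El G → Raw G ℋ
    h a = x ⁻¹ ▸ (f (conj x a) x ⊟ f x a)

    h-InSum : ∀ a → InSum G ℋ (h a)
    h-InSum a = InSum-▸ (x ⁻¹) (InSum-⊟ (f-InSum _ _) (f-InSum _ _))

    private
      combine : ∀ P₁ P₂ P₃ P₄ Q₁ Q₂ Q₄ R₁ R₃ R₄ k₁ k₂ k₃ →
                ((P₁ - P₂) + P₃) - P₄ ≡ 0ℤ + k₁ →
                ((Q₁ - Q₂) + P₃) - Q₄ ≡ 0ℤ + k₂ →
                ((R₁ - Q₂) + R₃) - R₄ ≡ 0ℤ + k₃ →
                P₄ ≡ (R₁ + (((P₁ - Q₁) - (P₂ - R₃)) + (Q₄ - R₄))) + (k₂ - k₁ - k₃)
      combine P₁ P₂ P₃ P₄ Q₁ Q₂ Q₄ R₁ R₃ R₄ k₁ k₂ k₃ e₁ e₂ e₃ =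
        ≡-from-difference (cong₂ _+_ (cong₂ _+_ (sym e₁) e₂) (sym e₃)) (rearrange P₁ P₂ P₃ P₄ Q₁ Q₂ Q₄ R₁ R₃ R₄ k₁ k₂ k₃)
        where
        rearrange : ∀ P₁ P₂ P₃ P₄ Q₁ Q₂ Q₄ R₁ R₃ R₄ k₁ k₂ k₃ →
          P₄ - ((R₁ + (((P₁ - Q₁) - (P₂ - R₃)) + (Q₄ - R₄))) + (k₂ - k₁ - k₃)) ≡
          ((0ℤ + k₁) + (((Q₁ - Q₂) + P₃) - Q₄) + (0ℤ + k₃)) -
          ((((P₁ - P₂) + P₃) - P₄) + (0ℤ + k₂) + (((R₁ - Q₂) + R₃) - R₄))
        rearrange = solve-∀

    -- The sum of the cocycle identities at (a′, b′, x), (a′, x, b) and (x, a, b),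
    -- where a′ = conj x a and b′ = conj x b.
    conj-homotopy : ∀ a b → x ⁻¹ ▸ f (conj x a) (conj x b) ≈ f a b ⊞ coboundary h a b
    conj-homotopy a b = ⟪ _ , (λ i y → combine
      (f (conj x b) x i (y ∙ a ∙ x ⁻¹)) (f (conj x (a ∙ b)) x i (y ∙ x ⁻¹)) (f (conj x a) (x ∙ b) i (y ∙ x ⁻¹))
      (f (conj x a) (conj x b) i (y ∙ x ⁻¹)) (f x b i (y ∙ a ∙ x ⁻¹)) (f (x ∙ a) b i (y ∙ x ⁻¹))
      (f (conj x a) x i (y ∙ x ⁻¹)) (f a b i y) (f x (a ∙ b) i (y ∙ x ⁻¹)) (f x a i (y ∙ x ⁻¹))
      (κ (conj x a) (conj x b) x) (κ (conj x a) x b) (κ x a b)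
      (cocycle-at (conj x a) (conj x b) x i (y ∙ x ⁻¹) (conj-∙ x a b) (conj-∙-self x b) (∙⁻¹∙conj x y a))
      (cocycle-at (conj x a) x b i (y ∙ x ⁻¹) (conj-∙-self x a) refl (∙⁻¹∙conj x y a))
      (cocycle-at x a b i (y ∙ x ⁻¹) refl refl (//-rightDividesˡ x y))) ⟫

    cyclicClass-conj : ∀ g s → pow G g s ≡ ε →
      cyclicClass g s ≈ x ⁻¹ ▸ cyclicClass (conj x g) s ⊟ norm g s (h g)
    cyclicClass-conj g s gˢ≡ε = begin
      cyclicClass g s
        ≈⟨ ∑ᴿ-cong s (λ {k} _ → ⊞-isolateˡ (conj-homotopy (pow G g k) g)) ⟩
      ∑ᴿ s (λ k → x ⁻¹ ▸ f (conj x (pow G g k)) (conj x g) ⊟ coboundary h (pow G g k) g)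
        ≈⟨ ≐⇒≈ (λ i y → ∑-- s (λ k → f (conj x (pow G g k)) (conj x g) i (y ∙ x ⁻¹)) (λ k → coboundary h (pow G g k) g i y)) ⟩
      x ⁻¹ ▸ ∑ᴿ s (λ k → f (conj x (pow G g k)) (conj x g)) ⊟ ∑ᴿ s (λ k → coboundary h (pow G g k) g)
        ≈⟨ ≐⇒≈ (λ i y → cong₂ _-_ (∑-cong s (λ k → cong (λ t → f t (conj x g) i (y ∙ x ⁻¹)) (sym (pow-conj x g k))))
                                   (∑-coboundary g s h gˢ≡ε i y)) ⟩
      x ⁻¹ ▸ cyclicClass (conj x g) s ⊟ norm g s (h g) ∎
      where open ≈-Reasoning

module CyclicRestriction (G : FinGroup) (ℋ : List (Subset (FinGroup.order G)))
                         (fc : Cochain2 G ℋ) (coc : IsCocycle G ℋ fc) (σ : El G) where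

  open import Data.Integer using (_+_; _-_)
  open import Data.Integer.Tactic.RingSolver using (solve-∀)

  open FinGroupProperties G
  open Coefficients G ℋ
  open Cocycle G ℋ fc coc

  σ^ : ℕ → El G
  σ^ = pow G σ

  n : ℕ
  n = ord σ

  u : ℕ → Raw G ℋ
  u k = f ε ε ⊟ ∑ᴿ k (λ t → f (σ^ t) σ)

  u-InSum : ∀ k → InSum G ℋ (u k)
  u-InSum k = InSum-⊟ (f-InSum ε ε) (InSum-∑ᴿ k (λ t → f-InSum (σ^ t) σ))

  f-σᵗ-σ : ∀ t → f (σ^ t) σ ≐ u t ⊟ u (suc t)
  f-σᵗ-σ t i x = begin
    F t                                   ≡⟨ rearrange (F t) (f ε ε i x) (∑ t F) ⟩
    (f ε ε i x - ∑ t F) - (f ε ε i x - (∑ t F + F t)) ≡⟨ cong (λ s → (f ε ε i x - ∑ t F) - (f ε ε i x - s)) (∑-last t F) ⟨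
    (f ε ε i x - ∑ t F) - (f ε ε i x - ∑ (suc t) F) ∎
    where
    open ≡-Reasoning
    F : ℕ → ℤ
    F k = f (σ^ k) σ i x
    rearrange : ∀ a e s → a ≡ (e - s) - (e - (s + a))
    rearrange = solve-∀

  f-σⁱ-σʲ : ∀ i j → f (σ^ i) (σ^ j) ≈ (σ^ i ▸ u j ⊟ u (i ℕ.+ j)) ⊞ u i
  f-σⁱ-σʲ i zero = ≈-trans (f-ε-right (σ^ i)) (≐⇒≈ λ k x → rearrange _ _ _ (cong (λ t → u t k x) (ℕ.+-identityʳ i)))
    where
    rearrange : ∀ a b c → b ≡ c → a ≡ ((a - 0ℤ) - b) + c
    rearrange a b .b refl = cancel a b
      where
      cancel : ∀ a b → a ≡ ((a - 0ℤ) - b) + b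
      cancel = solve-∀
  f-σⁱ-σʲ i (suc j) = begin
    f (σ^ i) (σ^ (suc j))
      ≈⟨ ≐⇒≈ (λ k x → cong (λ t → f (σ^ i) t k x) (pow-sucʳ σ j)) ⟩
    f (σ^ i) (σ^ j ∙ σ)
      ≈⟨ cocycle (σ^ i) (σ^ j) σ ⟩
    (f (σ^ i) (σ^ j) ⊟ σ^ i ▸ f (σ^ j) σ) ⊞ f (σ^ i ∙ σ^ j) σ
      ≈⟨ ≐⇒≈ (λ k x → cong (λ t → ((f (σ^ i) (σ^ j) ⊟ σ^ i ▸ f (σ^ j) σ) ⊞ f t σ) k x) (sym (pow-+ σ i j))) ⟩
    (f (σ^ i) (σ^ j) ⊟ σ^ i ▸ f (σ^ j) σ) ⊞ f (σ^ (i ℕ.+ j)) σ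
      ≈⟨ ⊞-cong (⊟-cong (f-σⁱ-σʲ i j) (≐⇒≈ (λ k x → f-σᵗ-σ j k (x ∙ σ^ i)))) (≐⇒≈ (f-σᵗ-σ (i ℕ.+ j))) ⟩
    (((σ^ i ▸ u j ⊟ u (i ℕ.+ j)) ⊞ u i) ⊟ σ^ i ▸ (u j ⊟ u (suc j))) ⊞ (u (i ℕ.+ j) ⊟ u (suc (i ℕ.+ j)))
      ≈⟨ ≐⇒≈ (λ k x → trans
           (rearrange (u j k (x ∙ σ^ i)) (u (suc j) k (x ∙ σ^ i)) (u (i ℕ.+ j) k x) (u (suc (i ℕ.+ j)) k x) (u i k x))
           (cong (λ t → (u (suc j) k (x ∙ σ^ i) - u t k x) + u i k x) (sym (ℕ.+-suc i j)))) ⟩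
    (σ^ i ▸ u (suc j) ⊟ u (i ℕ.+ suc j)) ⊞ u i ∎
    where
    open ≈-Reasoning
    rearrange : ∀ uj uj₊ uij uij₊ ui → (((uj - uij) + ui) - (uj - uj₊)) + (uij - uij₊) ≡ (uj₊ - uij₊) + ui
    rearrange = solve-∀

  -- Represents the image of [f] in Ĥ⁰(⟨σ⟩, J) = J^σ / N_σ J.
  A : Raw G ℋ
  A = cyclicClass σ n

  A-InSum : InSum G ℋ A
  A-InSum = cyclicClass-InSum σ n

  σⁿ▸ : ∀ φ → σ^ n ▸ φ ≐ φ
  σⁿ▸ φ i x = trans (cong (λ t → φ i (x ∙ t)) (pow-ord σ)) (cong (φ i) (identityʳ x))

  private
    σ¹▸ : ∀ φ → σ^ 1 ▸ φ ≐ σ ▸ φ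
    σ¹▸ φ i x = cong (λ t → φ i (x ∙ t)) (identityʳ σ)

  u-+n : ∀ j → u (n ℕ.+ j) ≈ u j ⊟ A
  u-+n j = begin
    u (n ℕ.+ j)
      ≈⟨ ≐⇒≈ (λ i x → expand (u (n ℕ.+ j) i x) (u j i (x ∙ σ^ n)) (u n i x)) ⟩
    (σ^ n ▸ u j ⊞ u n) ⊟ ((σ^ n ▸ u j ⊟ u (n ℕ.+ j)) ⊞ u n)
      ≈⟨ ⊟-cong (≈-refl {σ^ n ▸ u j ⊞ u n}) (≈-sym (f-σⁱ-σʲ n j)) ⟩
    (σ^ n ▸ u j ⊞ u n) ⊟ f (σ^ n) (σ^ j)
      ≈⟨ ⊟-cong (⊞-cong (≐⇒≈ (σⁿ▸ (u j))) (≈-refl {u n})) f-σⁿ-σʲ ⟩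
    (u j ⊞ u n) ⊟ f ε ε
      ≈⟨ ≐⇒≈ (λ i x → cancel (u j i x) (f ε ε i x) (A i x)) ⟩
    u j ⊟ A ∎
    where
    open ≈-Reasoning
    f-σⁿ-σʲ : f (σ^ n) (σ^ j) ≈ f ε ε
    f-σⁿ-σʲ = ≈-trans (≐⇒≈ (λ i x → cong (λ t → f t (σ^ j) i x) (pow-ord σ))) (f-ε-left (σ^ j))
    expand : ∀ r q s → r ≡ (q + s) - ((q - r) + s)
    expand = solve-∀
    cancel : ∀ a e s → (a + (e - s)) - e ≡ a - s
    cancel = solve-∀

  σ▸A≈A : σ ▸ A ≈ A
  σ▸A≈A = begin
    σ ▸ A
      ≈⟨ ≐⇒≈ (λ i x → split (f ε ε i (x ∙ σ)) (A i (x ∙ σ))) ⟩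
    σ ▸ f ε ε ⊟ σ ▸ u n
      ≈⟨ ⊟-cong (≈-sym (f-ε-right σ)) ≈-refl ⟩
    f σ ε ⊟ σ ▸ u n
      ≈⟨ ≐⇒≈ (λ i x → cong₂ (λ a b → f a b i x - u n i (x ∙ σ)) (sym (identityʳ σ)) (sym (pow-ord σ))) ⟩
    f (σ^ 1) (σ^ n) ⊟ σ ▸ u n
      ≈⟨ ⊟-cong (f-σⁱ-σʲ 1 n) ≈-refl ⟩
    ((σ^ 1 ▸ u n ⊟ u (1 ℕ.+ n)) ⊞ u 1) ⊟ σ ▸ u n
      ≈⟨ ⊟-cong (⊞-cong (⊟-cong (≐⇒≈ (σ¹▸ (u n)))
                                (≈-trans (≐⇒≈ (λ i x → cong (λ t → u t i x) (ℕ.+-comm 1 n))) (u-+n 1)))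
                        ≈-refl)
                ≈-refl ⟩
    ((σ ▸ u n ⊟ (u 1 ⊟ A)) ⊞ u 1) ⊟ σ ▸ u n
      ≈⟨ ≐⇒≈ (λ i x → cancel (u n i (x ∙ σ)) (u 1 i x) (A i x)) ⟩
    A ∎
    where
    open ≈-Reasoning
    split : ∀ e s → s ≡ e - (e - s)
    split = solve-∀
    cancel : ∀ a b s → ((a - (b - s)) + b) - a ≡ s
    cancel = solve-∀

  A-fixed : ∀ i x → A i (x ∙ σ) ≡ A i x
  A-fixed = ▸-fixed (pow-ord σ) σ▸A≈A

  A-fixed-pow : ∀ k i x → A i (x ∙ σ^ k) ≡ A i x
  A-fixed-pow zero    i x = cong (A i) (identityʳ x)
  A-fixed-pow (suc k) i x = begin
    A i (x ∙ σ^ (suc k)) ≡⟨ cong (A i) (trans (cong (x ∙_) (pow-sucʳ σ k)) (sym (assoc _ _ _))) ⟩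
    A i (x ∙ σ^ k ∙ σ)   ≡⟨ A-fixed i _ ⟩
    A i (x ∙ σ^ k)       ≡⟨ A-fixed-pow k i x ⟩
    A i x                ∎
    where open ≡-Reasoning

  module CoboundaryCriterion (b : Raw G ℋ) (b-InSum : InSum G ℋ b) (A≈Nb : A ≈ norm σ n b) where

    -- Adding the partial norms of b makes u periodic modulo n, so that it descends to ⟨σ⟩.
    w : ℕ → Raw G ℋ
    w k = u k ⊞ norm σ k b

    w-InSum : ∀ k → InSum G ℋ (w k)
    w-InSum k = InSum-⊞ (u-InSum k) (InSum-norm σ k b-InSum)

    f-σⁱ-σʲ-w : ∀ i j → f (σ^ i) (σ^ j) ≈ (σ^ i ▸ w j ⊟ w (i ℕ.+ j)) ⊞ w i
    f-σⁱ-σʲ-w i j = ≈-trans (f-σⁱ-σʲ i j) (≐⇒≈ λ y x →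
      trans (rearrange (u j y (x ∙ σ^ i)) (u (i ℕ.+ j) y x) (u i y x) (norm σ i b y x) (norm σ j b y (x ∙ σ^ i)))
            (cong (λ t → ((u j y (x ∙ σ^ i) + norm σ j b y (x ∙ σ^ i)) - (u (i ℕ.+ j) y x + t)) + w i y x)
                  (sym (norm-+ σ i j b y x))))
      where
      rearrange : ∀ a c d Nᵢ Nⱼ → (a - c) + d ≡ ((a + Nⱼ) - (c + (Nᵢ + Nⱼ))) + (d + Nᵢ)
      rearrange = solve-∀

    w-+n : ∀ j → w (n ℕ.+ j) ≈ w j
    w-+n j = begin
      u (n ℕ.+ j) ⊞ norm σ (n ℕ.+ j) b ≈⟨ ⊞-cong (u-+n j) (≐⇒≈ (norm-+ σ n j b)) ⟩
      (u j ⊟ A) ⊞ (norm σ n b ⊞ σ^ n ▸ norm σ j b)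
        ≈⟨ ⊞-cong (≈-refl {u j ⊟ A}) (⊞-cong (≈-sym A≈Nb) (≐⇒≈ (σⁿ▸ (norm σ j b)))) ⟩
      (u j ⊟ A) ⊞ (A ⊞ norm σ j b) ≈⟨ ≐⇒≈ (λ y x → cancel (u j y x) (A y x) (norm σ j b y x)) ⟩
      w j ∎
      where
      open ≈-Reasoning
      cancel : ∀ a s d → (a - s) + (s + d) ≡ a + d
      cancel = solve-∀

    w-+*n : ∀ r c → w (r ℕ.+ c ℕ.* n) ≈ w r
    w-+*n r zero    = ≐⇒≈ (λ y x → cong (λ t → w t y x) (ℕ.+-identityʳ r))
    w-+*n r (suc c) = ≈-trans (≐⇒≈ (λ y x → cong (λ t → w t y x) shuffle)) (≈-trans (w-+n (r ℕ.+ c ℕ.* n)) (w-+*n r c))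
      where
      shuffle : r ℕ.+ (n ℕ.+ c ℕ.* n) ≡ n ℕ.+ (r ℕ.+ c ℕ.* n)
      shuffle = trans (sym (ℕ.+-assoc r n _)) (trans (cong (ℕ._+ c ℕ.* n) (ℕ.+-comm r n)) (ℕ.+-assoc n r _))

    w-respects-pow : ∀ p q → σ^ p ≡ σ^ q → w p ≈ w q
    w-respects-pow p q σᵖ≡σᑫ with ℕ.≤-total q p
    ... | inj₁ q≤p = let (c , p≡q+cn) = pow-≡⇒≡+*ord q≤p σᵖ≡σᑫ in
      ≈-trans (≐⇒≈ (λ y x → cong (λ t → w t y x) p≡q+cn)) (w-+*n q c)
    ... | inj₂ p≤q = let (c , q≡p+cn) = pow-≡⇒≡+*ord p≤q (sym σᵖ≡σᑫ) in
      ≈-sym (≈-trans (≐⇒≈ (λ y x → cong (λ t → w t y x) q≡p+cn)) (w-+*n p c))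

    exponent : El G → ℕ
    exponent x with powerOf? σ x
    ... | yes (k , _) = k
    ... | no _        = 0

    exponent-correct : ∀ {x} → ∃[ k ] x ≡ σ^ k → x ≡ σ^ (exponent x)
    exponent-correct {x} x∈⟨σ⟩ with powerOf? σ x
    ... | yes (_ , x≡σᵏ) = x≡σᵏ
    ... | no x∉⟨σ⟩       = ⊥-elim (x∉⟨σ⟩ x∈⟨σ⟩)

    v : El G → Raw G ℋ
    v x = w (exponent x)

    coboundary-on-⟨σ⟩ : ∀ {a c} → ∃[ k ] a ≡ σ^ k → ∃[ k ] c ≡ σ^ k → f a c ≈ coboundary v a c
    coboundary-on-⟨σ⟩ {a} {c} a∈⟨σ⟩ c∈⟨σ⟩ = begin
      f a c
        ≈⟨ ≐⇒≈ (λ y x → cong₂ (λ s t → f s t y x) a≡σᵃ c≡σᶜ) ⟩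
      f (σ^ α) (σ^ γ)
        ≈⟨ f-σⁱ-σʲ-w α γ ⟩
      (σ^ α ▸ w γ ⊟ w (α ℕ.+ γ)) ⊞ w α
        ≈⟨ ⊞-cong (⊟-cong (≐⇒≈ (λ y x → cong (λ t → w γ y (x ∙ t)) (sym a≡σᵃ)))
                          (w-respects-pow (α ℕ.+ γ) (exponent (a ∙ c)) σᵃ⁺ᶜ≡σ^ac))
                  (≈-refl {w α}) ⟩
      coboundary v a c ∎
      where
      open ≈-Reasoning
      α γ : ℕ
      α = exponent a
      γ = exponent c
      a≡σᵃ : a ≡ σ^ α
      a≡σᵃ = exponent-correct a∈⟨σ⟩
      c≡σᶜ : c ≡ σ^ γ
      c≡σᶜ = exponent-correct c∈⟨σ⟩
      σᵃ⁺ᶜ≡ac : σ^ (α ℕ.+ γ) ≡ a ∙ c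
      σᵃ⁺ᶜ≡ac = trans (pow-+ σ α γ) (sym (cong₂ _∙_ a≡σᵃ c≡σᶜ))
      σᵃ⁺ᶜ≡σ^ac : σ^ (α ℕ.+ γ) ≡ σ^ (exponent (a ∙ c))
      σᵃ⁺ᶜ≡σ^ac = trans σᵃ⁺ᶜ≡ac (exponent-correct (α ℕ.+ γ , sym σᵃ⁺ᶜ≡ac))

    coboundary-criterion : ∀ D → (∀ x → (x ∈ D) ⇔ (∃[ k ] x ≡ σ^ k)) → ResIsCoboundary G ℋ fc D
    coboundary-criterion D D≡⟨σ⟩ = (v , λ x → w-InSum (exponent x)) , λ a c a∈D c∈D →
      un (coboundary-on-⟨σ⟩ (Equivalence.to (D≡⟨σ⟩ a) a∈D) (Equivalence.to (D≡⟨σ⟩ c) c∈D))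

module NormsFromSubgroups (G : FinGroup) (ℋ : List (Subset (FinGroup.order G)))
                          (fc : Cochain2 G ℋ) (coc : IsCocycle G ℋ fc) (σ : El G) where

  open import Data.Integer using (_+_; _-_; _*_)
  open import Data.Integer.Tactic.RingSolver using (solve-∀)
  open import Data.Nat.GCD using (gcd; gcd[m,n]∣m; gcd[m,n]∣n; gcd-GCD; module Bézout)

  open FinGroupProperties G
  open Coefficients G ℋ
  open Cocycle G ℋ fc coc
  open CyclicRestriction G ℋ fc coc σ

  record NormFrom (m : ℕ) : Set where
    field
      index   : ℕ
      m*index : m ℕ.* index ≡ n
      ψ       : Raw G ℋ
      ψ-InSum : InSum G ℋ ψ
      A≈Nψ    : A ≈ norm (σ^ m) index ψ

  σᵐˢ≡ε : ∀ m s → m ℕ.* s ≡ n → pow G (σ^ m) s ≡ ε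
  σᵐˢ≡ε m s m*s≡n = trans (sym (pow-* σ m s)) (trans (cong σ^ m*s≡n) (pow-ord σ))

  cyclicClass-σᵐ : ∀ m s → m ℕ.* s ≡ n → cyclicClass (σ^ m) s ≈ norm (σ^ m) s (u m) ⊞ A
  cyclicClass-σᵐ m s m*s≡n = ≈-trans
    (∑ᴿ-cong s (λ {k} _ → ≈-trans (≐⇒≈ (λ i y → cong (λ t → f t (σ^ m) i y) (sym (pow-* σ m k)))) (f-σⁱ-σʲ (m ℕ.* k) m)))
    (≐⇒≈ telescope)
    where
    telescope : ∑ᴿ s (λ k → (σ^ (m ℕ.* k) ▸ u m ⊟ u (m ℕ.* k ℕ.+ m)) ⊞ u (m ℕ.* k)) ≐ norm (σ^ m) s (u m) ⊞ A
    telescope i y = begin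
      ∑ s (λ k → (u m i (y ∙ σ^ (m ℕ.* k)) - u (m ℕ.* k ℕ.+ m) i y) + U k)
        ≡⟨ ∑-cong s (λ k → cong₂ (λ t t′ → (u m i (y ∙ t) - u t′ i y) + U k) (pow-* σ m k)
                                 (trans (ℕ.+-comm (m ℕ.* k) m) (sym (ℕ.*-suc m k)))) ⟩
      ∑ s (λ k → (u m i (y ∙ pow G (σ^ m) k) - U (suc k)) + U k)
        ≡⟨ ∑-cong s (λ k → rearrange (u m i (y ∙ pow G (σ^ m) k)) (U (suc k)) (U k)) ⟩
      ∑ s (λ k → u m i (y ∙ pow G (σ^ m) k) + (U k - U (suc k)))
        ≡⟨ ∑-+ s _ _ ⟩
      norm (σ^ m) s (u m) i y + ∑ s (λ k → U k - U (suc k))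
        ≡⟨ cong (norm (σ^ m) s (u m) i y +_) (∑-telescope s U) ⟩
      norm (σ^ m) s (u m) i y + (U 0 - U s)
        ≡⟨ cong₂ (λ t t′ → norm (σ^ m) s (u m) i y + (u t i y - u t′ i y)) (ℕ.*-zeroʳ m) m*s≡n ⟩
      norm (σ^ m) s (u m) i y + (u 0 i y - u n i y)
        ≡⟨ cong (norm (σ^ m) s (u m) i y +_) (cancel (f ε ε i y) (A i y)) ⟩
      norm (σ^ m) s (u m) i y + A i y ∎
      where
      open ≡-Reasoning
      U : ℕ → ℤ
      U k = u (m ℕ.* k) i y
      rearrange : ∀ a b c → (a - b) + c ≡ a + (c - b)
      rearrange = solve-∀
      cancel : ∀ e a → (e - 0ℤ) - (e - a) ≡ a
      cancel = solve-∀

  normFrom-conj : ∀ {m s} x → m ℕ.* s ≡ n → ResIsCoboundary G ℋ fc ⟨ conj x (σ^ m) ⟩ → NormFrom m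
  normFrom-conj {m} {s} x m*s≡n ((v , v-InSum) , f≈∂v) = record
    { index = s ; m*index = m*s≡n
    ; ψ = (x ⁻¹ ▸ v τ′ ⊟ h τ) ⊟ u m
    ; ψ-InSum = InSum-⊟ (InSum-⊟ (InSum-▸ (x ⁻¹) (v-InSum τ′)) (h-InSum τ)) (u-InSum m)
    ; A≈Nψ = begin
        A
          ≈⟨ ⊞-isolateʳ (cyclicClass-σᵐ m s m*s≡n) ⟩
        cyclicClass τ s ⊟ norm τ s (u m)
          ≈⟨ ⊟-cong (cyclicClass-conj τ s τˢ≡ε) (≈-refl {norm τ s (u m)}) ⟩
        (x ⁻¹ ▸ cyclicClass τ′ s ⊟ norm τ s (h τ)) ⊟ norm τ s (u m)
          ≈⟨ ⊟-cong (⊟-cong (▸-cong (x ⁻¹) τ′-class) (≈-refl {norm τ s (h τ)})) (≈-refl {norm τ s (u m)}) ⟩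
        (x ⁻¹ ▸ norm τ′ s (v τ′) ⊟ norm τ s (h τ)) ⊟ norm τ s (u m)
          ≈⟨ ≐⇒≈ (λ i y → sym (trans (norm-⊟ τ s (x ⁻¹ ▸ v τ′ ⊟ h τ) (u m) i y)
                    (cong (_- norm τ s (u m) i y) (trans (norm-⊟ τ s (x ⁻¹ ▸ v τ′) (h τ) i y)
                      (cong (_- norm τ s (h τ) i y) (sym (▸-norm-conj x τ s (v τ′) i y))))))) ⟩
        norm τ s ((x ⁻¹ ▸ v τ′ ⊟ h τ) ⊟ u m) ∎ }
    where
    open ≈-Reasoning
    open Conjugation x
    τ τ′ : El G
    τ  = σ^ m
    τ′ = conj x τ
    τˢ≡ε : pow G τ s ≡ ε
    τˢ≡ε = σᵐˢ≡ε m s m*s≡n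
    τ′ˢ≡ε : pow G τ′ s ≡ ε
    τ′ˢ≡ε = trans (pow-conj x τ s) (trans (cong (conj x) τˢ≡ε) (conj-ε x))
    τ′∈⟨τ′⟩ : τ′ ∈ ⟨ τ′ ⟩
    τ′∈⟨τ′⟩ = subst (_∈ ⟨ τ′ ⟩) (identityʳ τ′) (pow∈⟨⟩ τ′ 1)
    τ′-class : cyclicClass τ′ s ≈ norm τ′ s (v τ′)
    τ′-class = cyclicClass-coboundary τ′ s v τ′ˢ≡ε (λ {k} _ → ⟪ f≈∂v (pow G τ′ k) τ′ (pow∈⟨⟩ τ′ k) τ′∈⟨τ′⟩ ⟫)

  normFrom-n : NormFrom n
  normFrom-n = record
    { index = 1 ; m*index = ℕ.*-identityʳ n ; ψ = A ; ψ-InSum = A-InSum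
    ; A≈Nψ = ≐⇒≈ (λ i x → sym (trans (ℤ.+-identityʳ _) (cong (A i) (identityʳ x)))) }

  norm-transfer : ∀ {m} d e (N : NormFrom m) → m ≡ e ℕ.* d →
                  norm (σ^ d) (e ℕ.* NormFrom.index N) (NormFrom.ψ N) ≈ ℤ.+ e · A
  norm-transfer {m} d e N m≡e*d = begin
    norm (σ^ d) (e ℕ.* s) ψ
      ≈⟨ ≐⇒≈ (norm-split (σ^ d) e s ψ) ⟩
    norm (σ^ d) e (norm (pow G (σ^ d) e) s ψ)
      ≈⟨ ≐⇒≈ (λ i x → cong (λ g → norm (σ^ d) e (norm g s ψ) i x) σᵈᵉ≡σᵐ) ⟩
    norm (σ^ d) e (norm (σ^ m) s ψ)
      ≈⟨ norm-cong (σ^ d) e (≈-sym A≈Nψ) ⟩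
    norm (σ^ d) e A
      ≈⟨ ≐⇒≈ (norm-fixed (σ^ d) e A (λ k i x → trans (cong (λ t → A i (x ∙ t)) (sym (pow-* σ d k))) (A-fixed-pow (d ℕ.* k) i x))) ⟩
    ℤ.+ e · A ∎
    where
    open ≈-Reasoning
    open NormFrom N renaming (index to s)
    σᵈᵉ≡σᵐ : pow G (σ^ d) e ≡ σ^ m
    σᵈᵉ≡σᵐ = trans (sym (pow-* σ d e)) (cong σ^ (trans (ℕ.*-comm d e) (sym m≡e*d)))

  private
    -- A = X·(e₁·A) − Y·(e₂·A), and each eⱼ·A is a norm from ⟨σᵈ⟩ by norm-transfer.
    bézout-combine : ∀ {m₁ m₂} d e₁ e₂ X Y → NormFrom m₁ → NormFrom m₂ →
                     m₁ ≡ e₁ ℕ.* d → m₂ ≡ e₂ ℕ.* d → d ℕ.+ Y ℕ.* m₂ ≡ X ℕ.* m₁ → NormFrom d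
    bézout-combine {m₁} {m₂} d e₁ e₂ X Y N₁ N₂ m₁≡e₁d m₂≡e₂d bézout = record
      { index = e₁ ℕ.* s₁ ; m*index = d*s≡n
      ; ψ = ℤ.+ X · ψ₁ ⊟ ℤ.+ Y · ψ₂
      ; ψ-InSum = InSum-⊟ (InSum-· (ℤ.+ X) (NormFrom.ψ-InSum N₁)) (InSum-· (ℤ.+ Y) (NormFrom.ψ-InSum N₂))
      ; A≈Nψ = A≈Nψ }
      where
      open NormFrom N₁ using () renaming (index to s₁; ψ to ψ₁)
      open NormFrom N₂ using () renaming (index to s₂; ψ to ψ₂)
      s : ℕ
      s = e₁ ℕ.* s₁
      regroup : ∀ e s′ → d ℕ.* (e ℕ.* s′) ≡ (e ℕ.* d) ℕ.* s′
      regroup e s′ = trans (sym (ℕ.*-assoc d e s′)) (cong (ℕ._* s′) (ℕ.*-comm d e))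
      d*s≡n : d ℕ.* s ≡ n
      d*s≡n = trans (regroup e₁ s₁) (trans (cong (ℕ._* s₁) (sym m₁≡e₁d)) (NormFrom.m*index N₁))
      instance
        d≢0 : NonZero d
        d≢0 = ℕ.m*n≢0⇒m≢0 d {{subst NonZero (sym d*s≡n) ord-nonZero}}
      e₂s₂≡s : e₂ ℕ.* s₂ ≡ s
      e₂s₂≡s = ℕ.*-cancelˡ-≡ _ _ d
        (trans (regroup e₂ s₂) (trans (cong (ℕ._* s₂) (sym m₂≡e₂d)) (trans (NormFrom.m*index N₂) (sym d*s≡n))))
      X*e₁≡1+Y*e₂ : X ℕ.* e₁ ≡ 1 ℕ.+ Y ℕ.* e₂
      X*e₁≡1+Y*e₂ = ℕ.*-cancelʳ-≡ _ _ d (begin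
        X ℕ.* e₁ ℕ.* d         ≡⟨ ℕ.*-assoc X e₁ d ⟩
        X ℕ.* (e₁ ℕ.* d)       ≡⟨ cong (X ℕ.*_) m₁≡e₁d ⟨
        X ℕ.* m₁               ≡⟨ bézout ⟨
        d ℕ.+ Y ℕ.* m₂         ≡⟨ cong (λ t → d ℕ.+ Y ℕ.* t) m₂≡e₂d ⟩
        d ℕ.+ Y ℕ.* (e₂ ℕ.* d) ≡⟨ cong (d ℕ.+_) (ℕ.*-assoc Y e₂ d) ⟨
        (1 ℕ.+ Y ℕ.* e₂) ℕ.* d ∎)
        where open ≡-Reasoning
      X*e₁≡1+Y*e₂ᶻ : ℤ.+ X * ℤ.+ e₁ ≡ 1ℤ + ℤ.+ Y * ℤ.+ e₂
      X*e₁≡1+Y*e₂ᶻ = trans (sym (ℤ.pos-* X e₁))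
        (trans (cong ℤ.+_ X*e₁≡1+Y*e₂) (trans (ℤ.pos-+ 1 (Y ℕ.* e₂)) (cong (1ℤ +_) (ℤ.pos-* Y e₂))))
      unit : ∀ a → a ≡ ℤ.+ X * (ℤ.+ e₁ * a) - ℤ.+ Y * (ℤ.+ e₂ * a)
      unit a = ≡-from-difference (cong (_* a) (sym X*e₁≡1+Y*e₂ᶻ)) (rearrange a (ℤ.+ X) (ℤ.+ Y) (ℤ.+ e₁) (ℤ.+ e₂))
        where
        rearrange : ∀ a x y e₁ e₂ → a - (x * (e₁ * a) - y * (e₂ * a)) ≡ (1ℤ + y * e₂) * a - (x * e₁) * a
        rearrange = solve-∀
      A≈Nψ : A ≈ norm (σ^ d) s (ℤ.+ X · ψ₁ ⊟ ℤ.+ Y · ψ₂)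
      A≈Nψ = begin
        A
          ≈⟨ ≐⇒≈ (λ i x → unit (A i x)) ⟩
        ℤ.+ X · ℤ.+ e₁ · A ⊟ ℤ.+ Y · ℤ.+ e₂ · A
          ≈⟨ ⊟-cong (·-cong (ℤ.+ X) (≈-sym (norm-transfer d e₁ N₁ m₁≡e₁d)))
                    (·-cong (ℤ.+ Y) (≈-sym (norm-transfer d e₂ N₂ m₂≡e₂d))) ⟩
        ℤ.+ X · norm (σ^ d) (e₁ ℕ.* s₁) ψ₁ ⊟ ℤ.+ Y · norm (σ^ d) (e₂ ℕ.* s₂) ψ₂
          ≈⟨ ≐⇒≈ (λ i x → sym (trans (norm-⊟ (σ^ d) s (ℤ.+ X · ψ₁) (ℤ.+ Y · ψ₂) i x)
               (cong₂ _-_ (norm-· (σ^ d) s (ℤ.+ X) ψ₁ i x)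
                          (trans (norm-· (σ^ d) s (ℤ.+ Y) ψ₂ i x) (cong (λ t → ℤ.+ Y * norm (σ^ d) t ψ₂ i x) (sym e₂s₂≡s)))))) ⟩
        norm (σ^ d) s (ℤ.+ X · ψ₁ ⊟ ℤ.+ Y · ψ₂) ∎
        where open ≈-Reasoning

  normFrom-gcd : ∀ {m₁ m₂} → NormFrom m₁ → NormFrom m₂ → NormFrom (gcd m₁ m₂)
  normFrom-gcd {m₁} {m₂} N₁ N₂ with gcd[m,n]∣m m₁ m₂ | gcd[m,n]∣n m₁ m₂ | Bézout.identity (gcd-GCD m₁ m₂)
  ... | divides e₁ m₁≡e₁d | divides e₂ m₂≡e₂d | Bézout.+- X Y bézout =
    bézout-combine (gcd m₁ m₂) e₁ e₂ X Y N₁ N₂ m₁≡e₁d m₂≡e₂d bézout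
  ... | divides e₁ m₁≡e₁d | divides e₂ m₂≡e₂d | Bézout.-+ X Y bézout =
    bézout-combine (gcd m₁ m₂) e₂ e₁ Y X N₂ N₁ m₂≡e₂d m₁≡e₁d bézout

  module _ {I : Set} (m : I → ℕ) where

    gcd-of : List I → ℕ
    gcd-of = foldr (λ p d → gcd (m p) d) n

    normFrom-gcd-of : (∀ p → NormFrom (m p)) → ∀ L → NormFrom (gcd-of L)
    normFrom-gcd-of N []      = normFrom-n
    normFrom-gcd-of N (p ∷ L) = normFrom-gcd (N p) (normFrom-gcd-of N L)

    gcd-of-∣ : ∀ {p L} → p ∈ₗ L → gcd-of L ∣ m p
    gcd-of-∣ {L = q ∷ L} (here refl) = gcd[m,n]∣m (m q) (gcd-of L)
    gcd-of-∣ {L = q ∷ L} (there p∈L) = ∣-trans (gcd[m,n]∣n (m q) (gcd-of L)) (gcd-of-∣ p∈L)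

module DoubleCosets (G : FinGroup) {H : Subset (FinGroup.order G)} (H-sub : IsSubgroup G H) where

  open import Data.Nat.Tactic.RingSolver using (solve-∀)

  open FinGroupProperties G
  open Subgroup H-sub

  SameOrbit : El G → El G → El G → Set
  SameOrbit τ z y = ∃[ j ] z ∙ (y ∙ pow G τ j) ⁻¹ ∈ H

  sameOrbit? : ∀ τ z y → Dec (SameOrbit τ z y)
  sameOrbit? τ z y with ℕ.anyUpTo? (λ j → z ∙ (y ∙ pow G τ j) ⁻¹ ∈? H) (ord τ)
  ... | yes (j , _ , z∈Hyτʲ) = yes (j , z∈Hyτʲ)
  ... | no none = no λ (j , z∈Hyτʲ) →
    none (j % ord τ , m%n<n j (ord τ) , subst (λ t → z ∙ (y ∙ t) ⁻¹ ∈ H) (pow-% (pow-ord τ) j) z∈Hyτʲ)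

  sameOrbit-refl : ∀ τ y → SameOrbit τ y y
  sameOrbit-refl τ y = 0 , subst (_∈ H) (sym (trans (cong (λ t → y ∙ t ⁻¹) (identityʳ y)) (inverseʳ y))) ε∈

  sameOrbit-shift : ∀ τ t {z y} → SameOrbit τ z (y ∙ pow G τ t) ⇔ SameOrbit τ z y
  sameOrbit-shift τ t {z} {y} = mk⇔
    (λ (j , m) → t ℕ.+ j , subst (λ w → z ∙ w ⁻¹ ∈ H) (trans (assoc _ _ _) (cong (y ∙_) (sym (pow-+ τ t j)))) m)
    (λ (j , m) → j ℕ.+ t ℕ.* (ord τ ℕ.∸ 1) , subst (λ w → z ∙ w ⁻¹ ∈ H) (back j) m)
    where
    wrap : ∀ j → t ℕ.+ (j ℕ.+ t ℕ.* (ord τ ℕ.∸ 1)) ≡ j ℕ.+ t ℕ.* ord τ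
    wrap j with ord τ | ord-nonZero {τ}
    ... | suc o | _ = regroup t j o
      where
      regroup : ∀ t j o → t ℕ.+ (j ℕ.+ t ℕ.* o) ≡ j ℕ.+ t ℕ.* suc o
      regroup = solve-∀
    back : ∀ j → y ∙ pow G τ j ≡ y ∙ pow G τ t ∙ pow G τ (j ℕ.+ t ℕ.* (ord τ ℕ.∸ 1))
    back j = begin
      y ∙ pow G τ j                                          ≡⟨ cong (y ∙_) (pow-periodic (pow-ord τ) j t) ⟨
      y ∙ pow G τ (j ℕ.+ t ℕ.* ord τ)                        ≡⟨ cong (λ e → y ∙ pow G τ e) (wrap j) ⟨
      y ∙ pow G τ (t ℕ.+ (j ℕ.+ t ℕ.* (ord τ ℕ.∸ 1)))        ≡⟨ cong (y ∙_) (pow-+ τ t _) ⟩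
      y ∙ (pow G τ t ∙ pow G τ (j ℕ.+ t ℕ.* (ord τ ℕ.∸ 1)))  ≡⟨ assoc _ _ _ ⟨
      y ∙ pow G τ t ∙ pow G τ (j ℕ.+ t ℕ.* (ord τ ℕ.∸ 1))    ∎
      where open ≡-Reasoning

  sameOrbit-left : ∀ τ {z y h} → h ∈ H → SameOrbit τ z (h ∙ y) ⇔ SameOrbit τ z y
  sameOrbit-left τ {z} {y} {h} h∈H = mk⇔
    (λ (j , m) → j , ∙⁻¹∈⇒∈ h∈H (subst (_∈ H) (pull j) m))
    (λ (j , m) → j , subst (_∈ H) (sym (pull j)) (∙⁻¹∈ m h∈H))
    where
    pull : ∀ j → z ∙ (h ∙ y ∙ pow G τ j) ⁻¹ ≡ z ∙ (y ∙ pow G τ j) ⁻¹ ∙ h ⁻¹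
    pull j = trans (cong (λ w → z ∙ w ⁻¹) (assoc h y (pow G τ j)))
               (trans (cong (z ∙_) (⁻¹-anti-homo-∙ h (y ∙ pow G τ j))) (sym (assoc _ _ _)))

  private
    RepIndex : El G → El G → ℕ → Set
    RepIndex τ y t = ∃[ z ] toℕ z ≡ t × SameOrbit τ z y

    repIndex? : ∀ τ y t → Dec (RepIndex τ y t)
    repIndex? τ y t = Fin.any? (λ z → (toℕ z ℕ.≟ t) ×-dec sameOrbit? τ z y)

    leastRep : ∀ τ y → ∃ (Least (RepIndex τ y))
    leastRep τ y = least (repIndex? τ y) (y , refl , sameOrbit-refl τ y)

  rep : El G → El G → El G
  rep τ y = proj₁ (proj₁ (proj₂ (leastRep τ y)))

  rep-sameOrbit : ∀ τ y → SameOrbit τ (rep τ y) y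
  rep-sameOrbit τ y = proj₂ (proj₂ (proj₁ (proj₂ (leastRep τ y))))

  rep-cong : ∀ τ {y y′} → (∀ {z} → SameOrbit τ z y ⇔ SameOrbit τ z y′) → rep τ y ≡ rep τ y′
  rep-cong τ {y} {y′} same = Fin.toℕ-injective (begin
    toℕ (rep τ y)          ≡⟨ proj₁ (proj₂ (proj₁ (proj₂ (leastRep τ y)))) ⟩
    proj₁ (leastRep τ y)   ≡⟨ least-unique sameIndex (proj₂ (leastRep τ y)) (proj₂ (leastRep τ y′)) ⟩
    proj₁ (leastRep τ y′)  ≡⟨ proj₁ (proj₂ (proj₁ (proj₂ (leastRep τ y′)))) ⟨
    toℕ (rep τ y′)         ∎)
    where
    open ≡-Reasoning
    sameIndex : ∀ {t} → RepIndex τ y t ⇔ RepIndex τ y′ t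
    sameIndex = mk⇔ (λ (z , eq , o) → z , eq , Equivalence.to same o) (λ (z , eq , o) → z , eq , Equivalence.from same o)

module Representatives (G : FinGroup) (ℋ : List (Subset (FinGroup.order G)))
                       (fc : Cochain2 G ℋ) (coc : IsCocycle G ℋ fc) (σ : El G)
                       (H-sub : ∀ i → IsSubgroup G (lookup ℋ i)) where

  open import Data.Integer using (_+_; _-_)
  open import Data.Integer.Tactic.RingSolver using (solve-∀)

  open FinGroupProperties G
  open Coefficients G ℋ
  open Cocycle G ℋ fc coc
  open CyclicRestriction G ℋ fc coc σ
  open NormsFromSubgroups G ℋ fc coc σ

  H : Fin (k G ℋ) → Subset order
  H i = lookup ℋ i

  module DC i = DoubleCosets G (H-sub i)

  DividesStabilizers : ℕ → Set
  DividesStabilizers g = ∀ i w d → conj w (σ^ d) ∈ H i → g ∣ d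

  private
    %-≡-of-∣∸ : ∀ {p q m} .{{_ : NonZero m}} → q ≤ p → m ∣ p ∸ q → p % m ≡ q % m
    %-≡-of-∣∸ {p} {q} {m} q≤p (divides c p∸q≡c*m) = begin
      p % m                 ≡⟨ cong (_% m) (ℕ.m+[n∸m]≡n q≤p) ⟨
      (q ℕ.+ (p ∸ q)) % m   ≡⟨ cong (λ d → (q ℕ.+ d) % m) p∸q≡c*m ⟩
      (q ℕ.+ c ℕ.* m) % m   ≡⟨ [m+kn]%n≡m%n q c m ⟩
      q % m                 ∎
      where open ≡-Reasoning

    coset-quotient : ∀ y {p q} → q ≤ p → y ∙ σ^ p ∙ (y ∙ σ^ q) ⁻¹ ≡ conj (y ∙ σ^ q) (σ^ (p ∸ q))
    coset-quotient y {p} {q} q≤p = cong (_∙ (y ∙ σ^ q) ⁻¹) (trans (cong (y ∙_) (pow-∸ σ q≤p)) (sym (assoc _ _ _)))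

  module _ {g} (N : NormFrom g) (g-divides : DividesStabilizers g) where

    open NormFrom N renaming (index to s; ψ to ψ′; ψ-InSum to ψ′-InSum; A≈Nψ to A≈Nψ′)

    instance
      g≢0 : NonZero g
      g≢0 = ℕ.m*n≢0⇒m≢0 g {{subst NonZero (sym m*index) ord-nonZero}}

    τ : El G
    τ = σ^ g

    same-coset⇒≡-mod-g : ∀ i y p q → y ∙ σ^ p ∙ (y ∙ σ^ q) ⁻¹ ∈ H i → p % g ≡ q % g
    same-coset⇒≡-mod-g i y p q yσᵖ~yσᑫ with ℕ.≤-total q p
    ... | inj₁ q≤p = %-≡-of-∣∸ q≤p (g-divides i (y ∙ σ^ q) (p ∸ q) (subst (_∈ H i) (coset-quotient y q≤p) yσᵖ~yσᑫ))
    ... | inj₂ p≤q = sym (%-≡-of-∣∸ p≤q (g-divides i (y ∙ σ^ p) (q ∸ p)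
                       (subst (_∈ H i) (coset-quotient y p≤q) (Subgroup.∙⁻¹∈-sym (H-sub i) yσᵖ~yσᑫ))))

    μ : Fin (k G ℋ) → El G → El G
    μ i y = DC.rep i σ y

    μ-σ : ∀ i y t → μ i (y ∙ σ^ t) ≡ μ i y
    μ-σ i y t = DC.rep-cong i σ (DC.sameOrbit-shift i σ t)

    μ-τ : ∀ i y t → μ i (y ∙ pow G τ t) ≡ μ i y
    μ-τ i y t = trans (cong (λ a → μ i (y ∙ a)) (sym (pow-* σ g t))) (μ-σ i y (g ℕ.* t))

    -- ψ keeps ψ′ only on the ⟨τ⟩-orbit of the canonical point μ of each ⟨σ⟩-orbit of Hᵢ\G;
    -- as stabilisers lie in ⟨τ⟩, exactly one of the points y σᵗ, t < g, is kept.
    δ : Fin (k G ℋ) → El G → Bool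
    δ i y = does (DC.sameOrbit? i τ (μ i y) y)

    δ-sound : ∀ {i y} → δ i y ≡ true → DC.SameOrbit i τ (μ i y) y
    δ-sound {i} {y} = dec-true⁻¹ (DC.sameOrbit? i τ (μ i y) y)

    δ-cong : ∀ {i y y′} → μ i y ≡ μ i y′ → (∀ {z} → DC.SameOrbit i τ z y ⇔ DC.SameOrbit i τ z y′) → δ i y ≡ δ i y′
    δ-cong {i} {y} {y′} μ≡ same = trans (cong (λ z → does (DC.sameOrbit? i τ z y)) μ≡)
                                        (does-⇔ same (DC.sameOrbit? i τ (μ i y′) y) (DC.sameOrbit? i τ (μ i y′) y′))

    δ-τ : ∀ i y t → δ i (y ∙ pow G τ t) ≡ δ i y
    δ-τ i y t = δ-cong (μ-τ i y t) (DC.sameOrbit-shift i τ t)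

    δ-left : ∀ i {h} y → h ∈ H i → δ i (h ∙ y) ≡ δ i y
    δ-left i y h∈H = δ-cong (DC.rep-cong i σ (DC.sameOrbit-left i σ h∈H)) (DC.sameOrbit-left i τ h∈H)

    ψ : Raw G ℋ
    ψ i y = if δ i y then ψ′ i y else 0ℤ

    ψ-InSum : InSum G ℋ ψ
    ψ-InSum i h x h∈H = cong₂ (λ b v → if b then v else 0ℤ) (δ-left i x h∈H) (ψ′-InSum i h x h∈H)

    norm-τ-ψ : ∀ i y → norm τ s ψ i y ≡ (if δ i y then norm τ s ψ′ i y else 0ℤ)
    norm-τ-ψ i y with δ i y in δ≡
    ... | true  = ∑-cong s (λ j → cong (λ b → if b then ψ′ i (y ∙ pow G τ j) else 0ℤ) (trans (δ-τ i y j) δ≡))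
    ... | false = trans (∑-cong s (λ j → cong (λ b → if b then ψ′ i (y ∙ pow G τ j) else 0ℤ) (trans (δ-τ i y j) δ≡))) (∑-zero s)

    position : Fin (k G ℋ) → El G → ℕ
    position i y = proj₁ (DC.rep-sameOrbit i σ y) % g

    δ-position : ∀ i y → δ i (y ∙ σ^ (position i y)) ≡ true
    δ-position i y with DC.rep-sameOrbit i σ y
    ... | k , μ∈Hyσᵏ rewrite μ-σ i y (k % g) =
      dec-true (DC.sameOrbit? i τ (μ i y) _) (k / g , subst (λ a → μ i y ∙ a ⁻¹ ∈ H i) split μ∈Hyσᵏ)
      where
      split : y ∙ σ^ k ≡ y ∙ σ^ (k % g) ∙ pow G τ (k / g)
      split = begin
        y ∙ σ^ k
          ≡⟨ cong (λ e → y ∙ σ^ e) (trans (m≡m%n+[m/n]*n k g) (cong (k % g ℕ.+_) (ℕ.*-comm (k / g) g))) ⟩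
        y ∙ σ^ (k % g ℕ.+ g ℕ.* (k / g))
          ≡⟨ cong (y ∙_) (trans (pow-+ σ (k % g) _) (cong (σ^ (k % g) ∙_) (pow-* σ g (k / g)))) ⟩
        y ∙ (σ^ (k % g) ∙ pow G τ (k / g))
          ≡⟨ assoc _ _ _ ⟨
        y ∙ σ^ (k % g) ∙ pow G τ (k / g)
          ∎
        where open ≡-Reasoning

    position-unique : ∀ i y {t} → t < g → δ i (y ∙ σ^ t) ≡ true → t ≡ position i y
    position-unique i y {t} t<g δ≡true with δ-sound δ≡true | DC.rep-sameOrbit i σ y
    ... | j , μ∈Hyσᵗτʲ | k , μ∈Hyσᵏ = begin
      t                  ≡⟨ m<n⇒m%n≡m t<g ⟨
      t % g              ≡⟨ [m+kn]%n≡m%n t j g ⟨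
      (t ℕ.+ j ℕ.* g) % g ≡⟨ same-coset⇒≡-mod-g i y (t ℕ.+ j ℕ.* g) k (Subgroup.same-coset (H-sub i) μ∈Hyσᵗ⁺ʲᵍ μ∈Hyσᵏ) ⟩
      k % g              ∎
      where
      open ≡-Reasoning
      merge : y ∙ σ^ t ∙ pow G τ j ≡ y ∙ σ^ (t ℕ.+ j ℕ.* g)
      merge = trans (assoc _ _ _) (cong (y ∙_) (trans (cong (σ^ t ∙_) (sym (pow-* σ g j)))
                (trans (sym (pow-+ σ t (g ℕ.* j))) (cong (λ e → σ^ (t ℕ.+ e)) (ℕ.*-comm g j)))))
      μ∈Hyσᵗ⁺ʲᵍ : μ i y ∙ (y ∙ σ^ (t ℕ.+ j ℕ.* g)) ⁻¹ ∈ H i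
      μ∈Hyσᵗ⁺ʲᵍ = subst₂ (λ a b → a ∙ b ⁻¹ ∈ H i) (μ-σ i y t) merge μ∈Hyσᵗτʲ

    A≈Nψ : A ≈ norm σ n ψ
    A≈Nψ with A≈Nψ′
    ... | ⟪ κ , A≡Nψ′+κ ⟫ = ⟪ κ , (λ i y → ≡-from-difference (sym (sum-over-positions i y)) (rearrange (A i y) (norm σ n ψ i y) κ)) ⟫
      where
      rearrange : ∀ a m c → a - (m + c) ≡ (a - c) - m
      rearrange = solve-∀
      Nψ′≡A-κ : ∀ i y → norm τ s ψ′ i y ≡ A i y - κ
      Nψ′≡A-κ i y = ≡-from-difference (sym (A≡Nψ′+κ i y)) (shift (norm τ s ψ′ i y) (A i y) κ)
        where
        shift : ∀ m a c → m - (a - c) ≡ (m + c) - a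
        shift = solve-∀
      sum-over-positions : ∀ i y → norm σ n ψ i y ≡ A i y - κ
      sum-over-positions i y = begin
        norm σ n ψ i y
          ≡⟨ cong (λ e → norm σ e ψ i y) (sym m*index) ⟩
        norm σ (g ℕ.* s) ψ i y
          ≡⟨ norm-split σ g s ψ i y ⟩
        ∑ g (λ t → norm τ s ψ i (y ∙ σ^ t))
          ≡⟨ ∑-cong g (λ t → trans (norm-τ-ψ i (y ∙ σ^ t))
               (cong (λ v → if δ i (y ∙ σ^ t) then v else 0ℤ) (trans (Nψ′≡A-κ i (y ∙ σ^ t)) (cong (_- κ) (A-fixed-pow t i y))))) ⟩
        ∑ g (λ t → if δ i (y ∙ σ^ t) then A i y - κ else 0ℤ)
          ≡⟨ ∑-single g _ (m%n<n _ g) others ⟩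
        (if δ i (y ∙ σ^ (position i y)) then A i y - κ else 0ℤ)
          ≡⟨ cong (λ b → if b then A i y - κ else 0ℤ) (δ-position i y) ⟩
        A i y - κ ∎
        where
        open ≡-Reasoning
        others : ∀ {t} → t < g → t ≢ position i y → (if δ i (y ∙ σ^ t) then A i y - κ else 0ℤ) ≡ 0ℤ
        others {t} t<g t≢pos with δ i (y ∙ σ^ t) in δ≡
        ... | true  = ⊥-elim (t≢pos (position-unique i y t<g δ≡))
        ... | false = refl

module CyclicSubgroupsSuffice (G : FinGroup) (ℋ : List (Subset (FinGroup.order G))) (ℋ-sub : All (IsSubgroup G) ℋ)
                              (𝒟 : List (Subset (FinGroup.order G))) (adm : Admissible G 𝒟)
                              (fc : Cochain2 G ℋ) (coc : IsCocycle G ℋ fc)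
                              (sha : InSha G ℋ (InDℋ G ℋ 𝒟) fc) (σ : El G) where

  open FinGroupProperties G
  open Coefficients G ℋ
  open CyclicRestriction G ℋ fc coc σ
  open NormsFromSubgroups G ℋ fc coc σ

  H-sub : ∀ i → IsSubgroup G (lookup ℋ i)
  H-sub i = All.lookup ℋ-sub (∈-lookup i)

  open Representatives G ℋ fc coc σ H-sub

  module Stabilizer (i : Fin (k G ℋ)) (x : El G) where

    open Subgroup (H-sub i)

    InStabilizer : ℕ → Set
    InStabilizer d = conj x (σ^ d) ∈ H i

    σⁿ∈ : InStabilizer (suc (pred n))
    σⁿ∈ = subst InStabilizer (sym (ℕ.suc-pred n)) (subst (_∈ H i) (sym (trans (cong (conj x) (pow-ord σ)) (conj-ε x))) ε∈)

    private
      stabilizer-generator : ∃ (Generator InStabilizer)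
      stabilizer-generator = generator (λ d → conj x (σ^ d) ∈? H i) (conj-pow∈-differenceClosed x σ) (pred n , σⁿ∈)

    m : ℕ
    m = proj₁ stabilizer-generator

    m-∣ : ∀ {d} → InStabilizer d → m ∣ d
    m-∣ = Generator.∣member (proj₂ stabilizer-generator)

    normFrom-m : NormFrom m
    normFrom-m with m-∣ (subst InStabilizer (ℕ.suc-pred n) σⁿ∈)
    ... | divides q n≡q*m = normFrom-conj x (trans (ℕ.*-comm m q) (sym n≡q*m)) (sha T T∈𝒟₍ℋ₎)
      where
      T : Subset order
      T = ⟨ conj x (σ^ m) ⟩
      T⊆H : T ⊆ H i
      T⊆H = ⟨⟩⊆ (Generator.member (proj₂ stabilizer-generator))
      T∈𝒟₍ℋ₎ : InDℋ G ℋ 𝒟 T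
      T∈𝒟₍ℋ₎ = Admissible.cyclic adm T (⟨⟩-isCyclic _) , λ (_ , T⊈ℋ) → T⊈ℋ (H i) (∈-lookup i) T⊆H

  indexPairs : List (Fin (k G ℋ) × El G)
  indexPairs = cartesianProduct (allFin (k G ℋ)) (allFin order)

  stabilizerIndex : Fin (k G ℋ) × El G → ℕ
  stabilizerIndex (i , x) = Stabilizer.m i x

  g : ℕ
  g = gcd-of stabilizerIndex indexPairs

  g-divides : DividesStabilizers g
  g-divides i w d σᵈ∈ = ∣-trans (gcd-of-∣ stabilizerIndex (∈-cartesianProduct⁺ (∈-allFin i) (∈-allFin w)))
                                  (Stabilizer.m-∣ i w σᵈ∈)

  normFrom-g : NormFrom g
  normFrom-g = normFrom-gcd-of stabilizerIndex (λ (i , x) → Stabilizer.normFrom-m i x) indexPairs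

  coboundary-on-⟨σ⟩ : ∀ D → (∀ y → (y ∈ D) ⇔ (∃[ k ] y ≡ σ^ k)) → ResIsCoboundary G ℋ fc D
  coboundary-on-⟨σ⟩ = CoboundaryCriterion.coboundary-criterion (ψ normFrom-g g-divides)
    (ψ-InSum normFrom-g g-divides) (A≈Nψ normFrom-g g-divides)

theorem5p11 : (G : FinGroup) (ℋ : List (Subset (FinGroup.order G))) → All (IsSubgroup G) ℋ →
    (𝒟 : List (Subset (FinGroup.order G))) → Admissible G 𝒟 →
    (f : Cochain2 G ℋ) → IsCocycle G ℋ f →
    InSha G ℋ (λ D → D ∈ₗ 𝒟) f ⇔ InSha G ℋ (InDℋ G ℋ 𝒟) f
theorem5p11 G ℋ ℋ-sub 𝒟 adm f coc = mk⇔ (λ sha D (D∈𝒟 , _) → sha D D∈𝒟) from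
  where
  from : InSha G ℋ (InDℋ G ℋ 𝒟) f → InSha G ℋ (λ D → D ∈ₗ 𝒟) f
  from sha D D∈𝒟 with FinGroupProperties.isCyclic? G D
  ... | no ¬cyclic        = sha D (D∈𝒟 , λ (cyclic , _) → ¬cyclic cyclic)
  ... | yes (σ , D≡⟨σ⟩)   = CyclicSubgroupsSuffice.coboundary-on-⟨σ⟩ G ℋ ℋ-sub 𝒟 adm f coc sha σ D D≡⟨σ⟩
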